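{- Let $c$ be a nonnegative integer and let $T(c)$ be the tree described in the context, which has $n=c+4$ elements. The orbits of $\partial_K$ acting on $\mathcal{L}_m(T(c))$ are as follows. (a) For $m=n-2$, there is exactly one orbit, and it has size $m-1$. (b) For $m=n-1$: (i) if $c$ is even, there are exactly $3$ orbits, each of size $m-1$; (ii) if $c$ is odd, there are exactly $2$ orbits, one of size $m-1$ and one of size $2(m-1)$. (c) For $m=n$: (i) if $c$ is even, there are exactly $2$ orbits, each of size $m-1$; (ii) if $c$ is odd, there is exactly one orbit, of size $2(m-1)$.
   Context: $T(c)$ is the poset formed from a chain $\hat0\lessdot x_1\lessdot x_2\lessdot\cdots\lessdot x_c$ (of length $c$, i.e. with $c+1$ elements; its top element is $x_c$, or $\hat0$ if $c=0$) by adding two new maximal elements $u,v$ both covering the top element of the chain, and one new maximal element $w$ covering $\hat0$. For a positive integer $m$, an $m$-packed labeling of a finite poset $P$ is a surjection $L:P\to\{1,\dots,m\}$ such that $x<_P y$ implies $L(x)<L(y)$; $\mathcal{L}_m(P)$ is the set of them. $K$-promotion $\partial_K:\mathcal{L}_m(P)\to\mathcal{L}_m(P)$: given $L$, erase the labels of all elements labeled $1$; then for $i=2,\dots,m$ in turn, for every cover relation $x\lessdot y$ with $x$ currently unlabeled and $y$ currently labeled $i$, give $x$ label $i$ and erase the label of $y$ (simultaneously for all such pairs); finally decrease every existing label by $1$ and label every unlabeled element $m$. This is a bijection of $\mathcal{L}_m(P)$, and orbits are those of the cyclic group it generates. -}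

module Defs where

open import Data.Nat using (ℕ; zero; suc; _+_; _*_; _∸_; _≤_; _<_; _≡ᵇ_)
open import Data.Fin using (Fin; toℕ)
import Data.Fin as Fin
open import Data.Bool using (Bool; true; false; _∧_; if_then_else_)
open import Data.Maybe using (Maybe; just; nothing; is-nothing; maybe)
open import Data.List using (List; []; _∷_; _++_; map; foldl; upTo)
open import Data.Bool.ListAction using (any)

open import Data.List using (allFin)
open import Data.Product using (Σ; ∃; _×_; _,_)
open import Relation.Binary.PropositionalEquality using (_≡_)
open import Relation.Nullary using (¬_)

-- The poset T(c).
-- Elements: the chain 0̂ = x 0 ⋖ x 1 ⋖ ... ⋖ x c  (x i for i : Fin (suc c)),
-- and three extra maximal elements u, v (covering x c) and w (covering 0̂).

data Elem (c : ℕ) : Set where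
  x : Fin (suc c) → Elem c
  u : Elem c
  v : Elem c
  w : Elem c

size : ℕ → ℕ
size c = c + 4

elems : (c : ℕ) → List (Elem c)
elems c = map x (allFin (suc c)) ++ (u ∷ v ∷ w ∷ [])

data _<T_ {c : ℕ} : Elem c → Elem c → Set where
  x<x : ∀ {i j} → toℕ i < toℕ j → x i <T x j
  x<u : ∀ {i} → x i <T u
  x<v : ∀ {i} → x i <T v
  x<w : ∀ {i} → toℕ i ≡ 0 → x i <T w

cover : (c : ℕ) → Elem c → Elem c → Bool
cover c (x i) (x j) = toℕ j ≡ᵇ suc (toℕ i)
cover c (x i) u = toℕ i ≡ᵇ c
cover c (x i) v = toℕ i ≡ᵇ c
cover c (x i) w = toℕ i ≡ᵇ 0
cover c _ _ = false

IsLabeling : (c m : ℕ) → (Elem c → ℕ) → Set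
IsLabeling c m L =
  (∀ e → 1 ≤ L e × L e ≤ m)
  × (∀ k → 1 ≤ k → k ≤ m → ∃ λ e → L e ≡ k)
  × (∀ a b → a <T b → L a < L b)

_==?_ : Maybe ℕ → ℕ → Bool
nothing ==? i = false
just k ==? i = k ≡ᵇ i

slide : (c : ℕ) → ℕ → (Elem c → Maybe ℕ) → (Elem c → Maybe ℕ)
slide c i σ e with σ e
... | nothing = if any (λ y → cover c e y ∧ (σ y ==? i)) (elems c) then just i else nothing
... | just k  = if (k ≡ᵇ i) ∧ any (λ z → cover c z e ∧ is-nothing (σ z)) (elems c)
                then nothing else just k

stepsList : ℕ → List ℕ
stepsList m = map (λ j → j + 2) (upTo (m ∸ 1))

∂K : (c m : ℕ) → (Elem c → ℕ) → (Elem c → ℕ)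
∂K c m L e = maybe (λ k → k ∸ 1) m (final e)
  where
  start : Elem c → Maybe ℕ
  start a = if L a ≡ᵇ 1 then nothing else just (L a)
  final : Elem c → Maybe ℕ
  final = foldl (λ σ i → slide c i σ) start (stepsList m)

iter : ∀ {A : Set} → (A → A) → ℕ → A → A
iter f zero a = a
iter f (suc k) a = f (iter f k a)

_≗E_ : ∀ {c} → (Elem c → ℕ) → (Elem c → ℕ) → Set
L ≗E L' = ∀ e → L e ≡ L' e

SameOrbit : (c m : ℕ) → (Elem c → ℕ) → (Elem c → ℕ) → Set
SameOrbit c m L L' = ∃ λ k → iter (∂K c m) k L ≗E L'

OrbitSize : (c m : ℕ) → (Elem c → ℕ) → ℕ → Set
OrbitSize c m L k =
  0 < k × iter (∂K c m) k L ≗E L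
  × (∀ j → 0 < j → j < k → ¬ (iter (∂K c m) j L ≗E L))

Labeling : ℕ → ℕ → Set
Labeling c m = Σ (Elem c → ℕ) (IsLabeling c m)

OrbitsAre : (c m s : ℕ) → (Fin s → ℕ) → Set
OrbitsAre c m s sizes =
  Σ (Fin s → Labeling c m) λ rep →
    (∀ i → OrbitSize c m (Σ.proj₁ (rep i)) (sizes i))
    × (∀ i j → SameOrbit c m (Σ.proj₁ (rep i)) (Σ.proj₁ (rep j)) → i ≡ j)
    × (∀ (L : Elem c → ℕ) → IsLabeling c m L → ∃ λ i → SameOrbit c m (Σ.proj₁ (rep i)) L)

Even Odd : ℕ → Set
Even c = ∃ λ k → c ≡ 2 * k
Odd c = ∃ λ k → c ≡ 2 * k + 1

two : ℕ → ℕ → Fin 2 → ℕ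
two a b Fin.zero = a
two a b (Fin.suc _) = b

-- In a labeling of T(c) the chain x 0 ⋖ ⋯ ⋖ x c carries 1, 2, … with at most one value
-- skipped, the skipped value is the label a of w, and u and v carry values just above the
-- chain. Following the hole through the slides, ∂K lowers a by one (from 2 it wraps around
-- to m), shifts the chain down, and swaps which of u and v carries the smaller label unless
-- the hole is captured by w. So ∂K is conjugate to a countdown of a, together with a bit
-- saying whether u or v carries the smaller label; the parity of c decides whether that bit
-- is back after the m − 1 steps of the countdown (two orbits of size m − 1) or only after
-- 2(m − 1) steps (one orbit). For m = n − 1 the labelings with equal labels on u and v form
-- one more orbit of size m − 1, and for m = n − 2 they are the only labelings.

module Submission where

open import Defs
open import Data.Bool using (Bool; true; false; _∧_; if_then_else_; T; not)
open import Data.Bool.Properties using (∨-zeroʳ; not-involutive; not-¬; ¬-not) renaming (_≟_ to _≟ᵇ_)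
open import Data.Bool.ListAction using (any; or)
open import Data.Empty using (⊥; ⊥-elim)
open import Data.Fin using (Fin; toℕ)
import Data.Fin as Fin
import Data.Fin.Properties as Fin
open import Data.List using (List; []; _∷_; _∷ʳ_; map; foldl; allFin; applyUpTo)
open import Data.List.Membership.Propositional using (_∈_)
open import Data.List.Membership.Propositional.Properties using (∈-map⁺; ∈-++⁺ˡ; ∈-++⁺ʳ; ∈-allFin)
open import Data.List.Properties using (map-upTo; map-cong; applyUpTo-∷ʳ; foldl-∷ʳ)
open import Data.List.Relation.Unary.Any using (here; there)
open import Data.Maybe using (Maybe; just; nothing; is-nothing; maybe)
open import Data.Maybe.Properties using (just-injective)
open import Data.Nat using (ℕ; zero; suc; _+_; _*_; _∸_; _≤_; _<_; _≡ᵇ_; _<ᵇ_; _⊓_; z≤n; s≤s)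
open import Data.Nat.Properties
open import Data.Product using (∃; _×_; _,_; proj₁; proj₂)
open import Data.Sum using (_⊎_; inj₁; inj₂)
open import Function using (_∘_)
open import Relation.Binary.PropositionalEquality
open import Relation.Binary.Definitions using (tri<; tri≈; tri>)
open import Relation.Nullary using (¬_; yes; no)

T⇒≡true : ∀ {b} → T b → b ≡ true
T⇒≡true {true} _ = refl

≡ᵇ-refl : ∀ n → (n ≡ᵇ n) ≡ true
≡ᵇ-refl zero = refl
≡ᵇ-refl (suc n) = ≡ᵇ-refl n

≡ᵇ-true⇒≡ : ∀ {m n} → (m ≡ᵇ n) ≡ true → m ≡ n
≡ᵇ-true⇒≡ {m} {n} eq = ≡ᵇ⇒≡ m n (subst T (sym eq) _)

≡ᵇ-≢ : ∀ {m n} → m ≢ n → (m ≡ᵇ n) ≡ false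
≡ᵇ-≢ {m} {n} m≢n with m ≡ᵇ n in eq
... | false = refl
... | true = ⊥-elim (m≢n (≡ᵇ-true⇒≡ eq))

≡⇒≡ᵇ-true : ∀ {m n} → m ≡ n → (m ≡ᵇ n) ≡ true
≡⇒≡ᵇ-true {m} refl = ≡ᵇ-refl m

any-true : ∀ {A : Set} (p : A → Bool) {xs a} → a ∈ xs → p a ≡ true → any p xs ≡ true
any-true p (here refl) pa rewrite pa = refl
any-true p {y ∷ _} (there a∈xs) pa rewrite any-true p a∈xs pa = ∨-zeroʳ (p y)

any-false : ∀ {A : Set} (p : A → Bool) xs → (∀ a → p a ≡ false) → any p xs ≡ false
any-false p [] never = refl
any-false p (y ∷ ys) never rewrite never y = any-false p ys never

<ᵇ-irrefl : ∀ n → (n <ᵇ n) ≡ false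
<ᵇ-irrefl zero = refl
<ᵇ-irrefl (suc n) = <ᵇ-irrefl n

suc-∸1 : ∀ {a} → 1 ≤ a → suc (a ∸ 1) ≡ a
suc-∸1 (s≤s _) = refl

one-of-two : ∀ {n k} → n < k → k ≤ 2 + n → k ≡ 1 + n ⊎ k ≡ 2 + n
one-of-two {n} {k} n<k k≤2+n with k ≟ 1 + n
... | yes k≡ = inj₁ k≡
... | no k≢1+n = inj₂ (≤-antisym k≤2+n (≤∧≢⇒< n<k (≢-sym k≢1+n)))

one-of-three : ∀ {n k} → n < k → k ≤ 3 + n → k ≡ 1 + n ⊎ k ≡ 2 + n ⊎ k ≡ 3 + n
one-of-three {n} {k} n<k k≤3+n with k ≟ 1 + n | k ≟ 2 + n
... | yes k≡ | _ = inj₁ k≡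
... | no _ | yes k≡ = inj₂ (inj₁ k≡)
... | no k≢1+n | no k≢2+n = inj₂ (inj₂ (≤-antisym k≤3+n (≤∧≢⇒< (≤∧≢⇒< n<k (≢-sym k≢1+n)) (≢-sym k≢2+n))))

≤1+⇒≤∨≡ : ∀ {a k} → a ≤ suc k → a ≤ k ⊎ a ≡ suc k
≤1+⇒≤∨≡ a≤1+k with m≤n⇒m<n∨m≡n a≤1+k
... | inj₁ a<1+k = inj₁ (m<1+n⇒m≤n a<1+k)
... | inj₂ a≡1+k = inj₂ a≡1+k

iter-+ : ∀ {A : Set} (f : A → A) j k a → iter f (j + k) a ≡ iter f j (iter f k a)
iter-+ f zero k a = refl
iter-+ f (suc j) k a = cong f (iter-+ f j k a)

iter-commute : ∀ {A : Set} (f : A → A) k a → iter f k (f a) ≡ f (iter f k a)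
iter-commute f zero a = refl
iter-commute f (suc k) a = cong f (iter-commute f k a)

iter-not-even : ∀ k b → iter not (2 * k) b ≡ b
iter-not-even zero b = refl
iter-not-even (suc k) b rewrite +-suc k (k + 0) = trans (not-involutive _) (iter-not-even k b)

iter-not-invol : ∀ k b → iter not k (iter not k b) ≡ b
iter-not-invol k b = begin
  iter not k (iter not k b) ≡⟨ sym (iter-+ not k k b) ⟩
  iter not (k + k) b        ≡⟨ cong (λ n → iter not (k + n) b) (sym (+-identityʳ k)) ⟩
  iter not (2 * k) b        ≡⟨ iter-not-even k b ⟩
  b                          ∎
  where open ≡-Reasoning

iter-not-injective : ∀ n {b b'} → iter not n b ≡ iter not n b' → b ≡ b'
iter-not-injective n {b} {b'} eq = trans (sym (iter-not-invol n b)) (trans (cong (iter not n) eq) (iter-not-invol n b'))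

iter-not-Even : ∀ {n} → Even n → ∀ b → iter not n b ≡ b
iter-not-Even (k , refl) = iter-not-even k

iter-not-Odd : ∀ {n} → Odd n → ∀ b → iter not n b ≡ not b
iter-not-Odd (k , refl) b = trans (iter-+ not (2 * k) 1 b) (iter-not-even k (not b))

Even-2+ : ∀ {n} → Even n → Even (2 + n)
Even-2+ (k , refl) = suc k , sym (*-suc 2 k)

Odd-2+ : ∀ {n} → Odd n → Odd (2 + n)
Odd-2+ (k , refl) = suc k , cong (_+ 1) (sym (*-suc 2 k))

toℕ≤c : ∀ {c} (j : Fin (suc c)) → toℕ j ≤ c
toℕ≤c = Fin.toℕ≤pred[n]

fromℕ-clamped : (c n : ℕ) → Fin (suc c)
fromℕ-clamped c zero = Fin.zero
fromℕ-clamped zero (suc n) = Fin.zero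
fromℕ-clamped (suc c) (suc n) = Fin.suc (fromℕ-clamped c n)

toℕ-fromℕ-clamped : ∀ c n → n ≤ c → toℕ (fromℕ-clamped c n) ≡ n
toℕ-fromℕ-clamped c zero _ = refl
toℕ-fromℕ-clamped (suc c) (suc n) (s≤s n≤c) = cong suc (toℕ-fromℕ-clamped c n n≤c)

fromℕ-clamped-toℕ : ∀ {c} (j : Fin (suc c)) → fromℕ-clamped c (toℕ j) ≡ j
fromℕ-clamped-toℕ Fin.zero = refl
fromℕ-clamped-toℕ {suc c} (Fin.suc j) = cong Fin.suc (fromℕ-clamped-toℕ j)

-- Covers of T(c) and single slides

∈-elems : ∀ {c} (e : Elem c) → e ∈ elems c
∈-elems {c} (x j) = ∈-++⁺ˡ (∈-map⁺ x (∈-allFin j))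
∈-elems {c} u = ∈-++⁺ʳ (map x (allFin (suc c))) (here refl)
∈-elems {c} v = ∈-++⁺ʳ (map x (allFin (suc c))) (there (here refl))
∈-elems {c} w = ∈-++⁺ʳ (map x (allFin (suc c))) (there (there (here refl)))

_⋖_ : ∀ {c} → Elem c → Elem c → Set
_⋖_ {c} a b = cover c a b ≡ true

module _ {c : ℕ} where

  x⋖x : ∀ {i j : Fin (suc c)} → toℕ j ≡ suc (toℕ i) → x i ⋖ x j
  x⋖x = ≡⇒≡ᵇ-true

  x⋖u : ∀ {i : Fin (suc c)} → toℕ i ≡ c → x i ⋖ u
  x⋖u = ≡⇒≡ᵇ-true

  x⋖v : ∀ {i : Fin (suc c)} → toℕ i ≡ c → x i ⋖ v
  x⋖v = ≡⇒≡ᵇ-true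

  x⋖w : ∀ {i : Fin (suc c)} → toℕ i ≡ 0 → x i ⋖ w
  x⋖w = ≡⇒≡ᵇ-true

  module _ (P : Elem c → Set) where

    upper-covers-x : (j : Fin (suc c)) → (∀ j' → toℕ j' ≡ suc (toℕ j) → P (x j')) →
      (toℕ j ≡ c → P u) → (toℕ j ≡ c → P v) → (toℕ j ≡ 0 → P w) → ∀ y → x j ⋖ y → P y
    upper-covers-x j px pu pv pw (x j') j⋖ = px j' (≡ᵇ-true⇒≡ j⋖)
    upper-covers-x j px pu pv pw u j⋖ = pu (≡ᵇ-true⇒≡ j⋖)
    upper-covers-x j px pu pv pw v j⋖ = pv (≡ᵇ-true⇒≡ j⋖)
    upper-covers-x j px pu pv pw w j⋖ = pw (≡ᵇ-true⇒≡ j⋖)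

    lower-covers-x : (j : Fin (suc c)) → (∀ j' → toℕ j ≡ suc (toℕ j') → P (x j')) → ∀ z → z ⋖ x j → P z
    lower-covers-x j px (x j') ⋖j = px j' (≡ᵇ-true⇒≡ ⋖j)

    lower-covers-u : (∀ j' → toℕ j' ≡ c → P (x j')) → ∀ z → z ⋖ u → P z
    lower-covers-u px (x j') ⋖u = px j' (≡ᵇ-true⇒≡ ⋖u)

    lower-covers-v : (∀ j' → toℕ j' ≡ c → P (x j')) → ∀ z → z ⋖ v → P z
    lower-covers-v px (x j') ⋖v = px j' (≡ᵇ-true⇒≡ ⋖v)

    lower-covers-w : (∀ j' → toℕ j' ≡ 0 → P (x j')) → ∀ z → z ⋖ w → P z
    lower-covers-w px (x j') ⋖w = px j' (≡ᵇ-true⇒≡ ⋖w)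

  u-maximal : ∀ (y : Elem c) → ¬ u ⋖ y
  u-maximal _ ()

  v-maximal : ∀ (y : Elem c) → ¬ v ⋖ y
  v-maximal _ ()

  w-maximal : ∀ (y : Elem c) → ¬ w ⋖ y
  w-maximal _ ()

module SlideStep (c i : ℕ) (σ : Elem c → Maybe ℕ) where

  slide-fills : ∀ {e y} → σ e ≡ nothing → e ⋖ y → σ y ≡ just i → slide c i σ e ≡ just i
  slide-fills {e} {y} σe e⋖y σy rewrite σe
    | any-true (λ y → cover c e y ∧ (σ y ==? i)) (∈-elems y) (cong₂ _∧_ e⋖y (trans (cong (_==? i) σy) (≡ᵇ-refl i)))
    = refl

  no-upper-labelled : ∀ {e} → (∀ y → e ⋖ y → σ y ≢ just i) → ∀ y → (cover c e y ∧ (σ y ==? i)) ≡ false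
  no-upper-labelled {e} none y with cover c e y in e⋖y | σ y in σy
  ... | false | _ = refl
  ... | true | nothing = refl
  ... | true | just k = ≡ᵇ-≢ (λ k≡i → none y e⋖y (trans σy (cong just k≡i)))

  slide-stays-empty : ∀ {e} → σ e ≡ nothing → (∀ y → e ⋖ y → σ y ≢ just i) → slide c i σ e ≡ nothing
  slide-stays-empty {e} σe none rewrite σe
    | any-false (λ y → cover c e y ∧ (σ y ==? i)) (elems c) (no-upper-labelled {e} none)
    = refl

  slide-keeps : ∀ {e k} → σ e ≡ just k → k ≢ i → slide c i σ e ≡ just k
  slide-keeps σe k≢i rewrite σe | ≡ᵇ-≢ k≢i = refl

  slide-vacates : ∀ {e z} → σ e ≡ just i → z ⋖ e → σ z ≡ nothing → slide c i σ e ≡ nothing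
  slide-vacates {e} {z} σe z⋖e σz rewrite σe | ≡ᵇ-refl i
    | any-true (λ z → cover c z e ∧ is-nothing (σ z)) (∈-elems z) (cong₂ _∧_ z⋖e (cong is-nothing σz))
    = refl

  no-lower-empty : ∀ {e} → (∀ z → z ⋖ e → σ z ≢ nothing) → ∀ z → (cover c z e ∧ is-nothing (σ z)) ≡ false
  no-lower-empty {e} full z with cover c z e in z⋖e | σ z in σz
  ... | false | _ = refl
  ... | true | nothing = ⊥-elim (full z z⋖e σz)
  ... | true | just _ = refl

  slide-stays : ∀ {e} → σ e ≡ just i → (∀ z → z ⋖ e → σ z ≢ nothing) → slide c i σ e ≡ just i
  slide-stays {e} σe full rewrite σe | ≡ᵇ-refl i
    | any-false (λ z → cover c z e ∧ is-nothing (σ z)) (elems c) (no-lower-empty {e} full)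
    = refl

  slide-keeps-full : ∀ {e a} → σ e ≡ just a → (a ≡ i → ∀ z → z ⋖ e → σ z ≢ nothing) → slide c i σ e ≡ just a
  slide-keeps-full {a = a} σe full with a ≟ i
  ... | no a≢i = slide-keeps σe a≢i
  ... | yes refl = slide-stays σe (full refl)

  slide-maximal-empty : ∀ {e} → σ e ≡ nothing → (∀ y → ¬ e ⋖ y) → slide c i σ e ≡ nothing
  slide-maximal-empty σe maximal = slide-stays-empty σe (λ y e⋖y → ⊥-elim (maximal y e⋖y))

carries-larger : ∀ {o : Maybe ℕ} {a k} → o ≡ just a → k < a → o ≢ just k
carries-larger o≡a k<a o≡k = >⇒≢ k<a (just-injective (trans (sym o≡a) o≡k))

carries : ∀ {o : Maybe ℕ} {a} → o ≡ just a → o ≢ nothing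
carries refl ()

module NextSlide (c k : ℕ) (σ : Elem c → Maybe ℕ) where
  open SlideStep c (suc k) σ public

  σ' : Elem c → Maybe ℕ
  σ' = slide c (suc k) σ

  k<1+k : k < suc k
  k<1+k = n<1+n k

  ¬carries : Elem c → Set
  ¬carries y = σ y ≢ just (suc k)

  filled : Elem c → Set
  filled z = σ z ≢ nothing

  still-waiting : ∀ {e a} → (k < a → σ e ≡ just a) → suc k < a → σ' e ≡ just a
  still-waiting waiting 1+k<a = slide-keeps (waiting (<-trans k<1+k 1+k<a)) (>⇒≢ 1+k<a)

  waiting-larger : ∀ {e a} → (k < a → σ e ≡ just a) → suc k < a → ¬carries e
  waiting-larger waiting 1+k<a = carries-larger (waiting (<-trans k<1+k 1+k<a)) 1+k<a

  now-due : ∀ {e a} → (k < a → σ e ≡ just a) → a ≡ suc k → σ e ≡ just (suc k)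
  now-due waiting a≡ = trans (waiting (subst (k <_) (sym a≡) k<1+k)) (cong just a≡)

module _ {c : ℕ} where

  slides : (Elem c → Maybe ℕ) → List ℕ → Elem c → Maybe ℕ
  slides = foldl (λ σ i → slide c i σ)

  slides-invariant : (I : ℕ → (Elem c → Maybe ℕ) → Set) →
    (∀ k σ → 1 ≤ k → I k σ → I (suc k) (slide c (suc k) σ)) →
    ∀ {m σ} → 1 ≤ m → I 1 σ → I m (slides σ (stepsList m))
  slides-invariant I step {suc r} {σ} _ I₁ rewrite map-upTo (_+ 2) r = go r
    where
    go : ∀ r → I (suc r) (slides σ (applyUpTo (_+ 2) r))
    go zero = I₁
    go (suc r) = subst (I (suc (suc r))) (sym slides-snoc) (step (suc r) _ (s≤s z≤n) (go r))
      where
      open ≡-Reasoning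
      slides-snoc : slides σ (applyUpTo (_+ 2) (suc r)) ≡ slide c (suc (suc r)) (slides σ (applyUpTo (_+ 2) r))
      slides-snoc = begin
        slides σ (applyUpTo (_+ 2) (suc r))              ≡⟨ cong (slides σ) (sym (applyUpTo-∷ʳ (_+ 2) r)) ⟩
        slides σ (applyUpTo (_+ 2) r ∷ʳ (r + 2))        ≡⟨ foldl-∷ʳ (λ σ i → slide c i σ) σ (r + 2) (applyUpTo (_+ 2) r) ⟩
        slide c (r + 2) (slides σ (applyUpTo (_+ 2) r)) ≡⟨ cong (λ i → slide c i (slides σ (applyUpTo (_+ 2) r))) (+-comm r 2) ⟩
        slide c (suc (suc r)) (slides σ (applyUpTo (_+ 2) r)) ∎

slide-by : ℕ → Maybe ℕ → Bool → Bool → Maybe ℕ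
slide-by i nothing fill _ = if fill then just i else nothing
slide-by i (just k) _ vacate = if (k ≡ᵇ i) ∧ vacate then nothing else just k

slide-unfold : ∀ c i σ e → slide c i σ e ≡
  slide-by i (σ e) (any (λ y → cover c e y ∧ (σ y ==? i)) (elems c)) (any (λ z → cover c z e ∧ is-nothing (σ z)) (elems c))
slide-unfold c i σ e with σ e
... | nothing = refl
... | just k = refl

slide-cong : ∀ c i {σ σ'} → (∀ e → σ e ≡ σ' e) → ∀ e → slide c i σ e ≡ slide c i σ' e
slide-cong c i {σ} {σ'} σ≗σ' e = begin
  slide c i σ e  ≡⟨ slide-unfold c i σ e ⟩
  slide-by i (σ e) (fill σ) (vacate σ)
    ≡⟨ cong₂ (λ f b → f b) (cong₂ (slide-by i) (σ≗σ' e) (any-cong λ y → cong (λ o → cover c e y ∧ (o ==? i)) (σ≗σ' y)))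
                           (any-cong λ z → cong (λ o → cover c z e ∧ is-nothing o) (σ≗σ' z)) ⟩
  slide-by i (σ' e) (fill σ') (vacate σ')  ≡⟨ sym (slide-unfold c i σ' e) ⟩
  slide c i σ' e ∎
  where
  open ≡-Reasoning
  fill vacate : (Elem c → Maybe ℕ) → Bool
  fill τ = any (λ y → cover c e y ∧ (τ y ==? i)) (elems c)
  vacate τ = any (λ z → cover c z e ∧ is-nothing (τ z)) (elems c)
  any-cong : ∀ {p q : Elem c → Bool} → (∀ a → p a ≡ q a) → any p (elems c) ≡ any q (elems c)
  any-cong p≗q = cong or (map-cong p≗q (elems c))

slides-cong : ∀ {c} is {σ σ'} → (∀ e → σ e ≡ σ' e) → ∀ e → slides {c} σ is e ≡ slides σ' is e
slides-cong [] σ≗σ' = σ≗σ'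
slides-cong {c} (i ∷ is) σ≗σ' = slides-cong is (slide-cong c i σ≗σ')

∂K-cong : ∀ c m {L L'} → L ≗E L' → ∂K c m L ≗E ∂K c m L'
∂K-cong c m L≗L' e =
  cong (maybe (_∸ 1) m) (slides-cong (stepsList m) (λ a → cong (λ l → if l ≡ᵇ 1 then nothing else just l) (L≗L' a)) e)

-- Promotion of a labeling whose chain labels increase

module ChainPromotion (c m : ℕ) (L : Elem c → ℕ) (ℓ : ℕ → ℕ)
  (L-x : ∀ j → L (x j) ≡ ℓ (toℕ j)) (ℓ-0 : ℓ 0 ≡ 1) (ℓ-inc : ∀ n → n < c → ℓ n < ℓ (suc n))
  (ℓ<u : ℓ c < L u) (ℓ<v : ℓ c < L v) (1<w : 1 < L w)
  (ℓ≤m : ∀ n → n ≤ c → ℓ n ≤ m) (u≤m : L u ≤ m) (v≤m : L v ≤ m) (w≤m : L w ≤ m) where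

  -- The label that slides into x n once x n is emptied: the least one on an upper cover other than w.
  next : ℕ → ℕ
  next n = if n <ᵇ c then ℓ (suc n) else L u ⊓ L v

  next-below : ∀ {n} → n < c → next n ≡ ℓ (suc n)
  next-below n<c rewrite T⇒≡true (<⇒<ᵇ n<c) = refl

  next-top : next c ≡ L u ⊓ L v
  next-top rewrite <ᵇ-irrefl c = refl

  next-at-top : ∀ {n} → n ≡ c → next n ≡ L u ⊓ L v
  next-at-top refl = next-top

  n<ℓn : ∀ n → n ≤ c → n < ℓ n
  n<ℓn zero _ = ≤-reflexive (sym ℓ-0)
  n<ℓn (suc n) n<c = ≤-<-trans (n<ℓn n (<⇒≤ n<c)) (ℓ-inc n n<c)

  1≤ℓ : ∀ n → n ≤ c → 1 ≤ ℓ n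
  1≤ℓ n n≤c = ≤-<-trans z≤n (n<ℓn n n≤c)

  ℓ<next : ∀ n → n ≤ c → ℓ n < next n
  ℓ<next n n≤c with m≤n⇒m<n∨m≡n n≤c
  ... | inj₁ n<c rewrite next-below n<c = ℓ-inc n n<c
  ... | inj₂ refl rewrite next-top = ⊓-pres-m< ℓ<u ℓ<v

  next≤m : ∀ n → n ≤ c → next n ≤ m
  next≤m n n≤c with m≤n⇒m<n∨m≡n n≤c
  ... | inj₁ n<c rewrite next-below n<c = ℓ≤m (suc n) n<c
  ... | inj₂ refl rewrite next-top = ≤-trans (m⊓n≤m (L u) (L v)) u≤m

  1<u : 1 < L u
  1<u = ≤-<-trans (1≤ℓ c ≤-refl) ℓ<u

  1<v : 1 < L v
  1<v = ≤-<-trans (1≤ℓ c ≤-refl) ℓ<v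

  1≤m : 1 ≤ m
  1≤m = ≤-trans (<⇒≤ 1<w) w≤m

  start : Elem c → Maybe ℕ
  start e = if L e ≡ᵇ 1 then nothing else just (L e)

  start-labelled : ∀ {e} → 1 < L e → start e ≡ just (L e)
  start-labelled 1<e rewrite ≡ᵇ-≢ (>⇒≢ 1<e) = refl

  start-empty : ∀ {e} → L e ≡ 1 → start e ≡ nothing
  start-empty e≡1 rewrite e≡1 = refl

  final : Elem c → Maybe ℕ
  final = slides start (stepsList m)

  ∂K-final : ∀ {e k} → final e ≡ just k → ∂K c m L e ≡ k ∸ 1
  ∂K-final = cong (maybe (_∸ 1) m)

  ∂K-final-empty : ∀ {e} → final e ≡ nothing → ∂K c m L e ≡ m
  ∂K-final-empty = cong (maybe (_∸ 1) m)

  reach-final : (I : ℕ → (Elem c → Maybe ℕ) → Set) →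
    (∀ k σ → 1 ≤ k → I k σ → I (suc k) (slide c (suc k) σ)) → I 1 start → I m final
  reach-final I step = slides-invariant I step 1≤m

  toℕ≡⇒≤c : ∀ {j : Fin (suc c)} {n} → toℕ j ≡ n → n ≤ c
  toℕ≡⇒≤c {j} refl = toℕ≤c j

  L-xn : ∀ j {n} → toℕ j ≡ n → L (x j) ≡ ℓ n
  L-xn j tj = trans (L-x j) (cong ℓ tj)

  -- The stage after the slides for labels 2, …, i when w does not capture the hole
  -- starting at x 0: that hole runs up the chain and leaves through u or v.
  record ActiveStage (i : ℕ) (σ : Elem c → Maybe ℕ) : Set where
    field
      x-moved   : ∀ j n → toℕ j ≡ n → next n ≤ i → σ (x j) ≡ just (next n)
      x-hole    : ∀ j n → toℕ j ≡ n → i < next n → ℓ n ≤ i → σ (x j) ≡ nothing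
      x-waiting : ∀ j n → toℕ j ≡ n → i < ℓ n → σ (x j) ≡ just (ℓ n)
      u-hole    : L u ≤ i → L u ≤ L v → σ u ≡ nothing
      u-waiting : i < L u → σ u ≡ just (L u)
      u-kept    : L v < L u → σ u ≡ just (L u)
      v-hole    : L v ≤ i → L v ≤ L u → σ v ≡ nothing
      v-waiting : i < L v → σ v ≡ just (L v)
      v-kept    : L u < L v → σ v ≡ just (L v)
      w-hole    : L w ≤ i → L w ≤ next 0 → σ w ≡ nothing
      w-waiting : i < L w → σ w ≡ just (L w)
      w-kept    : next 0 < L w → σ w ≡ just (L w)

  active-start : ActiveStage 1 start
  active-start = record
    { x-moved = λ j n tj next≤1 → ⊥-elim (<⇒≱ (≤-<-trans (1≤ℓ n (toℕ≡⇒≤c tj)) (ℓ<next n (toℕ≡⇒≤c tj))) next≤1)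
    ; x-hole = λ j n tj _ ℓ≤1 → start-empty (trans (L-xn j tj) (≤-antisym ℓ≤1 (1≤ℓ n (toℕ≡⇒≤c tj))))
    ; x-waiting = λ j n tj 1<ℓ → trans (start-labelled (subst (1 <_) (sym (L-xn j tj)) 1<ℓ)) (cong just (L-xn j tj))
    ; u-hole = λ u≤1 _ → ⊥-elim (<⇒≱ 1<u u≤1)
    ; u-waiting = start-labelled
    ; u-kept = λ _ → start-labelled 1<u
    ; v-hole = λ v≤1 _ → ⊥-elim (<⇒≱ 1<v v≤1)
    ; v-waiting = start-labelled
    ; v-kept = λ _ → start-labelled 1<v
    ; w-hole = λ w≤1 _ → ⊥-elim (<⇒≱ 1<w w≤1)
    ; w-waiting = start-labelled
    ; w-kept = λ _ → start-labelled 1<w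
    }

  module ActiveStep (active : next 0 ≤ L w) (k : ℕ) (σ : Elem c → Maybe ℕ) (1≤k : 1 ≤ k)
    (S : ActiveStage k σ) where
    open ActiveStage S
    open NextSlide c k σ

    upper-carrier : ∀ j n → toℕ j ≡ n → next n ≡ suc k → ∃ λ y → x j ⋖ y × σ y ≡ just (suc k)
    upper-carrier j n tj next≡ with m≤n⇒m<n∨m≡n (toℕ≡⇒≤c tj)
    ... | inj₁ n<c = x j' , x⋖x (trans tj' (cong suc (sym tj))) , now-due (x-waiting j' (suc n) tj') (trans (sym (next-below n<c)) next≡)
      where
      j' : Fin (suc c)
      j' = fromℕ-clamped c (suc n)
      tj' : toℕ j' ≡ suc n
      tj' = toℕ-fromℕ-clamped c (suc n) n<c
    ... | inj₂ n≡c with ⊓-sel (L u) (L v)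
    ...   | inj₁ ⊓≡u = u , x⋖u (trans tj n≡c) , now-due u-waiting (trans (sym ⊓≡u) (trans (sym (next-at-top n≡c)) next≡))
    ...   | inj₂ ⊓≡v = v , x⋖v (trans tj n≡c) , now-due v-waiting (trans (sym ⊓≡v) (trans (sym (next-at-top n≡c)) next≡))

    x-moved' : ∀ j n → toℕ j ≡ n → next n ≤ suc k → σ' (x j) ≡ just (next n)
    x-moved' j n tj next≤ with ≤1+⇒≤∨≡ next≤
    ... | inj₁ next≤k = slide-keeps (x-moved j n tj next≤k) (<⇒≢ (s≤s next≤k))
    ... | inj₂ next≡ with upper-carrier j n tj next≡
    ...   | y , j⋖y , σy = trans (slide-fills (x-hole j n tj k<next ℓ≤k) j⋖y σy) (cong just (sym next≡))
      where
      k<next : k < next n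
      k<next = subst (k <_) (sym next≡) k<1+k
      ℓ≤k : ℓ n ≤ k
      ℓ≤k = m<1+n⇒m≤n (subst (ℓ n <_) next≡ (ℓ<next n (toℕ≡⇒≤c tj)))

    x-waiting' : ∀ j n → toℕ j ≡ n → suc k < ℓ n → σ' (x j) ≡ just (ℓ n)
    x-waiting' j n tj = still-waiting (x-waiting j n tj)

    x-hole' : ∀ j n → toℕ j ≡ n → suc k < next n → ℓ n ≤ suc k → σ' (x j) ≡ nothing
    x-hole' j n tj 1+k<next ℓ≤ with ≤1+⇒≤∨≡ ℓ≤
    ... | inj₁ ℓ≤k = slide-stays-empty (x-hole j n tj (<-trans k<1+k 1+k<next) ℓ≤k) (upper-covers-x ¬carries j above-x above-u above-v above-w)
      where
      above-x : ∀ j' → toℕ j' ≡ suc (toℕ j) → ¬carries (x j')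
      above-x j' tj' = waiting-larger (x-waiting j' (suc n) tj″) (subst (suc k <_) (next-below (toℕ≡⇒≤c tj″)) 1+k<next)
        where
        tj″ : toℕ j' ≡ suc n
        tj″ = trans tj' (cong suc tj)
      next-top≤ : ∀ {a} → toℕ j ≡ c → L u ⊓ L v ≤ a → next n ≤ a
      next-top≤ tc = subst (_≤ _) (sym (next-at-top (trans (sym tj) tc)))
      above-u : toℕ j ≡ c → ¬carries u
      above-u tc = waiting-larger u-waiting (<-≤-trans 1+k<next (next-top≤ tc (m⊓n≤m (L u) (L v))))
      above-v : toℕ j ≡ c → ¬carries v
      above-v tc = waiting-larger v-waiting (<-≤-trans 1+k<next (next-top≤ tc (m⊓n≤n (L u) (L v))))
      above-w : toℕ j ≡ 0 → ¬carries w
      above-w t0 = waiting-larger w-waiting (<-≤-trans 1+k<next (subst (_≤ L w) (cong next (trans (sym t0) tj)) active))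
    ... | inj₂ ℓ≡ = vacate n tj ℓ≡
      where
      vacate : ∀ n → toℕ j ≡ n → ℓ n ≡ suc k → σ' (x j) ≡ nothing
      vacate zero _ ℓ≡ = ⊥-elim (1+n≰n (subst (1 ≤_) (suc-injective (trans (sym ℓ≡) ℓ-0)) 1≤k))
      vacate (suc n') tj ℓ≡ =
        slide-vacates (now-due (x-waiting j (suc n') tj) ℓ≡)
                      (x⋖x (trans tj (cong suc (sym tz)))) (x-hole z n' tz k<next ℓ≤k)
        where
        n'<c : n' < c
        n'<c = toℕ≡⇒≤c tj
        z : Fin (suc c)
        z = fromℕ-clamped c n'
        tz : toℕ z ≡ n'
        tz = toℕ-fromℕ-clamped c n' (<⇒≤ n'<c)
        k<next : k < next n'
        k<next = subst (k <_) (sym (trans (next-below n'<c) ℓ≡)) k<1+k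
        ℓ≤k : ℓ n' ≤ k
        ℓ≤k = m<1+n⇒m≤n (subst (ℓ n' <_) ℓ≡ (ℓ-inc n' n'<c))

    vacated-by : ∀ {e} j n → toℕ j ≡ n → x j ⋖ e → σ e ≡ just (suc k) → suc k ≤ next n → ℓ n ≤ k → σ' e ≡ nothing
    vacated-by j n tj j⋖e σe 1+k≤next ℓ≤k = slide-vacates σe j⋖e (x-hole j n tj 1+k≤next ℓ≤k)

    top : Fin (suc c)
    top = fromℕ-clamped c c

    toℕ-top : toℕ top ≡ c
    toℕ-top = toℕ-fromℕ-clamped c c ≤-refl

    u-hole' : L u ≤ suc k → L u ≤ L v → σ' u ≡ nothing
    u-hole' u≤ u≤v with ≤1+⇒≤∨≡ u≤
    ... | inj₁ u≤k = slide-maximal-empty (u-hole u≤k u≤v) u-maximal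
    ... | inj₂ u≡ = vacated-by top c toℕ-top (x⋖u toℕ-top) (now-due u-waiting u≡)
      (≤-reflexive (sym (trans next-top (trans (m≤n⇒m⊓n≡m u≤v) u≡)))) (m<1+n⇒m≤n (subst (ℓ c <_) u≡ ℓ<u))

    v-hole' : L v ≤ suc k → L v ≤ L u → σ' v ≡ nothing
    v-hole' v≤ v≤u with ≤1+⇒≤∨≡ v≤
    ... | inj₁ v≤k = slide-maximal-empty (v-hole v≤k v≤u) v-maximal
    ... | inj₂ v≡ = vacated-by top c toℕ-top (x⋖v toℕ-top) (now-due v-waiting v≡)
      (≤-reflexive (sym (trans next-top (trans (m≥n⇒m⊓n≡n v≤u) v≡)))) (m<1+n⇒m≤n (subst (ℓ c <_) v≡ ℓ<v))

    w-hole' : L w ≤ suc k → L w ≤ next 0 → σ' w ≡ nothing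
    w-hole' w≤ w≤next with ≤1+⇒≤∨≡ w≤
    ... | inj₁ w≤k = slide-maximal-empty (w-hole w≤k w≤next) w-maximal
    ... | inj₂ w≡ = vacated-by Fin.zero 0 refl (x⋖w {c} {Fin.zero} refl) (now-due w-waiting w≡)
      (subst (_≤ next 0) w≡ w≤next) (subst (_≤ k) (sym ℓ-0) 1≤k)

    u-kept' : L v < L u → σ' u ≡ just (L u)
    u-kept' v<u = slide-keeps-full (u-kept v<u) λ u≡ → lower-covers-u filled λ j tj →
      carries (x-moved j c tj (m<1+n⇒m≤n (subst₂ _<_ (sym (trans next-top (m≥n⇒m⊓n≡n (<⇒≤ v<u)))) u≡ v<u)))

    v-kept' : L u < L v → σ' v ≡ just (L v)
    v-kept' u<v = slide-keeps-full (v-kept u<v) λ v≡ → lower-covers-v filled λ j tj →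
      carries (x-moved j c tj (m<1+n⇒m≤n (subst₂ _<_ (sym (trans next-top (m≤n⇒m⊓n≡m (<⇒≤ u<v)))) v≡ u<v)))

    w-kept' : next 0 < L w → σ' w ≡ just (L w)
    w-kept' next<w = slide-keeps-full (w-kept next<w) λ w≡ → lower-covers-w filled λ j tj →
      carries (x-moved j 0 tj (m<1+n⇒m≤n (subst (next 0 <_) w≡ next<w)))

    active-step : ActiveStage (suc k) σ'
    active-step = record
      { x-moved = x-moved' ; x-hole = x-hole' ; x-waiting = x-waiting'
      ; u-hole = u-hole' ; u-waiting = still-waiting u-waiting ; u-kept = u-kept'
      ; v-hole = v-hole' ; v-waiting = still-waiting v-waiting ; v-kept = v-kept'
      ; w-hole = w-hole' ; w-waiting = still-waiting w-waiting ; w-kept = w-kept'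
      }

  module Active (active : next 0 ≤ L w) where
    private
      S : ActiveStage m final
      S = reach-final ActiveStage (ActiveStep.active-step active) active-start
    open ActiveStage S

    ∂K-x : ∀ j → ∂K c m L (x j) ≡ next (toℕ j) ∸ 1
    ∂K-x j = ∂K-final (x-moved j (toℕ j) refl (next≤m (toℕ j) (toℕ≤c j)))

    ∂K-u-min : L u ≤ L v → ∂K c m L u ≡ m
    ∂K-u-min u≤v = ∂K-final-empty (u-hole u≤m u≤v)

    ∂K-u-max : L v < L u → ∂K c m L u ≡ L u ∸ 1
    ∂K-u-max v<u = ∂K-final (u-kept v<u)

    ∂K-v-min : L v ≤ L u → ∂K c m L v ≡ m
    ∂K-v-min v≤u = ∂K-final-empty (v-hole v≤m v≤u)

    ∂K-v-max : L u < L v → ∂K c m L v ≡ L v ∸ 1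
    ∂K-v-max u<v = ∂K-final (v-kept u<v)

    ∂K-w-min : L w ≤ next 0 → ∂K c m L w ≡ m
    ∂K-w-min w≤next = ∂K-final-empty (w-hole w≤m w≤next)

    ∂K-w-max : next 0 < L w → ∂K c m L w ≡ L w ∸ 1
    ∂K-w-max next<w = ∂K-final (w-kept next<w)

  -- The stage after the slides for labels 2, …, i when w captures the hole starting
  -- at x 0; nothing else moves.
  record InactiveStage (i : ℕ) (σ : Elem c → Maybe ℕ) : Set where
    field
      x₀-moved : ∀ j → toℕ j ≡ 0 → L w ≤ i → σ (x j) ≡ just (L w)
      x₀-hole  : ∀ j → toℕ j ≡ 0 → i < L w → σ (x j) ≡ nothing
      x-kept   : ∀ j n → toℕ j ≡ suc n → σ (x j) ≡ just (ℓ (suc n))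
      u-kept   : σ u ≡ just (L u)
      v-kept   : σ v ≡ just (L v)
      w-hole   : L w ≤ i → σ w ≡ nothing
      w-waiting : i < L w → σ w ≡ just (L w)

  inactive-start : InactiveStage 1 start
  inactive-start = record
    { x₀-moved = λ _ _ w≤1 → ⊥-elim (<⇒≱ 1<w w≤1)
    ; x₀-hole = λ j t0 _ → start-empty (trans (L-xn j t0) ℓ-0)
    ; x-kept = λ j n tj → trans (start-labelled (subst (1 <_) (sym (L-xn j tj)) (1<ℓ n (toℕ≡⇒≤c tj)))) (cong just (L-xn j tj))
    ; u-kept = start-labelled 1<u
    ; v-kept = start-labelled 1<v
    ; w-hole = λ w≤1 → ⊥-elim (<⇒≱ 1<w w≤1)
    ; w-waiting = start-labelled
    }
    where
    1<ℓ : ∀ n → suc n ≤ c → 1 < ℓ (suc n)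
    1<ℓ n n<c = ≤-<-trans (s≤s z≤n) (n<ℓn (suc n) n<c)

  toℕ-cases : ∀ (j : Fin (suc c)) → toℕ j ≡ 0 ⊎ ∃ λ n → toℕ j ≡ suc n
  toℕ-cases j with toℕ j
  ... | zero = inj₁ refl
  ... | suc n = inj₂ (n , refl)

  module InactiveStep (inactive : L w < next 0) (k : ℕ) (σ : Elem c → Maybe ℕ) (1≤k : 1 ≤ k)
    (S : InactiveStage k σ) where
    open InactiveStage S
    open NextSlide c k σ

    next₀≤ : ∀ {a} → c ≡ 0 → L u ⊓ L v ≤ a → next 0 ≤ a
    next₀≤ c≡0 = subst (_≤ _) (sym (next-at-top (sym c≡0)))

    x₀-moved' : ∀ j → toℕ j ≡ 0 → L w ≤ suc k → σ' (x j) ≡ just (L w)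
    x₀-moved' j t0 w≤ with ≤1+⇒≤∨≡ w≤
    ... | inj₁ w≤k = slide-keeps (x₀-moved j t0 w≤k) (<⇒≢ (s≤s w≤k))
    ... | inj₂ w≡ = trans (slide-fills (x₀-hole j t0 (subst (k <_) (sym w≡) k<1+k)) (x⋖w t0) (now-due w-waiting w≡))
                          (cong just (sym w≡))

    x₀-hole' : ∀ j → toℕ j ≡ 0 → suc k < L w → σ' (x j) ≡ nothing
    x₀-hole' j t0 1+k<w = slide-stays-empty (x₀-hole j t0 (<-trans k<1+k 1+k<w))
      (upper-covers-x ¬carries j above-x above-u above-v above-w)
      where
      1+k<next : suc k < next 0
      1+k<next = <-trans 1+k<w inactive
      above-x : ∀ j' → toℕ j' ≡ suc (toℕ j) → ¬carries (x j')
      above-x j' tj' = carries-larger (x-kept j' 0 tj″) (subst (suc k <_) (next-below (toℕ≡⇒≤c tj″)) 1+k<next)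
        where
        tj″ : toℕ j' ≡ 1
        tj″ = trans tj' (cong suc t0)
      above-u : toℕ j ≡ c → ¬carries u
      above-u tc = carries-larger u-kept (<-≤-trans 1+k<next (next₀≤ (trans (sym tc) t0) (m⊓n≤m (L u) (L v))))
      above-v : toℕ j ≡ c → ¬carries v
      above-v tc = carries-larger v-kept (<-≤-trans 1+k<next (next₀≤ (trans (sym tc) t0) (m⊓n≤n (L u) (L v))))
      above-w : toℕ j ≡ 0 → ¬carries w
      above-w _ = waiting-larger w-waiting 1+k<w

    chain-filled : ∀ j' → (toℕ j' ≡ 0 → L w ≤ k) → filled (x j')
    chain-filled j' w≤k with toℕ-cases j'
    ... | inj₁ t0 = carries (x₀-moved j' t0 (w≤k t0))
    ... | inj₂ (n , tn) = carries (x-kept j' n tn)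

    w≤k : next 0 ≤ suc k → L w ≤ k
    w≤k next≤ = m<1+n⇒m≤n (<-≤-trans inactive next≤)

    x-kept' : ∀ j n → toℕ j ≡ suc n → σ' (x j) ≡ just (ℓ (suc n))
    x-kept' j n tj = slide-keeps-full (x-kept j n tj) λ ℓ≡ → lower-covers-x filled j λ j' tj' → chain-filled j' λ t0 →
      let tj₁ = trans tj' (cong suc t0)
      in w≤k (≤-reflexive (trans (next-below (toℕ≡⇒≤c tj₁)) (trans (cong ℓ (trans (sym tj₁) tj)) ℓ≡)))

    u-kept' : σ' u ≡ just (L u)
    u-kept' = slide-keeps-full u-kept λ u≡ → lower-covers-u filled λ j' tc → chain-filled j' λ t0 →
      w≤k (next₀≤ (trans (sym tc) t0) (≤-trans (m⊓n≤m (L u) (L v)) (≤-reflexive u≡)))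

    v-kept' : σ' v ≡ just (L v)
    v-kept' = slide-keeps-full v-kept λ v≡ → lower-covers-v filled λ j' tc → chain-filled j' λ t0 →
      w≤k (next₀≤ (trans (sym tc) t0) (≤-trans (m⊓n≤n (L u) (L v)) (≤-reflexive v≡)))

    w-hole' : L w ≤ suc k → σ' w ≡ nothing
    w-hole' w≤ with ≤1+⇒≤∨≡ w≤
    ... | inj₁ w≤k = slide-maximal-empty (w-hole w≤k) w-maximal
    ... | inj₂ w≡ = slide-vacates (now-due w-waiting w≡) (x⋖w {c} {Fin.zero} refl)
                                  (x₀-hole Fin.zero refl (subst (k <_) (sym w≡) k<1+k))

    inactive-step : InactiveStage (suc k) σ'
    inactive-step = record
      { x₀-moved = x₀-moved' ; x₀-hole = x₀-hole' ; x-kept = x-kept'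
      ; u-kept = u-kept' ; v-kept = v-kept'
      ; w-hole = w-hole' ; w-waiting = still-waiting w-waiting
      }

  module Inactive (inactive : L w < next 0) where
    private
      S : InactiveStage m final
      S = reach-final InactiveStage (InactiveStep.inactive-step inactive) inactive-start
    open InactiveStage S

    ∂K-x₀ : ∀ j → toℕ j ≡ 0 → ∂K c m L (x j) ≡ L w ∸ 1
    ∂K-x₀ j t0 = ∂K-final (x₀-moved j t0 w≤m)

    ∂K-x : ∀ j n → toℕ j ≡ suc n → ∂K c m L (x j) ≡ ℓ (suc n) ∸ 1
    ∂K-x j n tj = ∂K-final (x-kept j n tj)

    ∂K-u : ∂K c m L u ≡ L u ∸ 1
    ∂K-u = ∂K-final u-kept

    ∂K-v : ∂K c m L v ≡ L v ∸ 1
    ∂K-v = ∂K-final v-kept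

    ∂K-w : ∂K c m L w ≡ m
    ∂K-w = ∂K-final-empty (w-hole w≤m)

-- Chains labelled by skip g

-- skip g enumerates 1, 2, … with the value g + 1 left out.
skip : ℕ → ℕ → ℕ
skip zero n = suc (suc n)
skip (suc g) zero = 1
skip (suc g) (suc n) = suc (skip g n)

skip-< : ∀ {g n} → n < g → skip g n ≡ suc n
skip-< {suc g} {zero} _ = refl
skip-< {suc g} {suc n} (s≤s n<g) = cong suc (skip-< n<g)

skip-≥ : ∀ {g n} → g ≤ n → skip g n ≡ suc (suc n)
skip-≥ {zero} _ = refl
skip-≥ {suc g} {suc n} (s≤s g≤n) = cong suc (skip-≥ g≤n)

1≤skip : ∀ g n → 1 ≤ skip g n
1≤skip zero n = s≤s z≤n
1≤skip (suc g) zero = ≤-refl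
1≤skip (suc g) (suc n) = s≤s z≤n

skip-inc : ∀ g n → skip g n < skip g (suc n)
skip-inc zero n = ≤-refl
skip-inc (suc g) zero = s≤s (1≤skip g 0)
skip-inc (suc g) (suc n) = s≤s (skip-inc g n)

skip-mono : ∀ g {n n'} → n ≤ n' → skip g n ≤ skip g n'
skip-mono zero n≤n' = s≤s (s≤s n≤n')
skip-mono (suc g) {zero} _ = 1≤skip (suc g) _
skip-mono (suc g) {suc n} (s≤s n≤n') = s≤s (skip-mono g n≤n')

skip-≤ : ∀ g n → skip g n ≤ suc (suc n)
skip-≤ zero n = ≤-refl
skip-≤ (suc g) zero = s≤s z≤n
skip-≤ (suc g) (suc n) = s≤s (skip-≤ g n)

skip-omits : ∀ g n → skip g n ≢ suc g
skip-omits zero n ()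
skip-omits (suc g) zero ()
skip-omits (suc g) (suc n) eq = skip-omits g n (suc-injective eq)

skip-consecutive : ∀ {g g' n} → n < g → n < g' → skip g n ≡ skip g' n
skip-consecutive n<g n<g' = trans (skip-< n<g) (sym (skip-< n<g'))

skipLabel : (c g p q a : ℕ) → Elem c → ℕ
skipLabel c g p q a (x j) = skip g (toℕ j)
skipLabel c g p q a u = p
skipLabel c g p q a v = q
skipLabel c g p q a w = a

module SkipPromotion (c m g p q a : ℕ) (p⊓q≡ : p ⊓ q ≡ skip (suc g) (suc c)) (1<a : 1 < a)
  (p≤m : p ≤ m) (q≤m : q ≤ m) (a≤m : a ≤ m) where

  chain<p : skip (suc g) c < p
  chain<p = <-≤-trans (skip-inc (suc g) c) (subst (_≤ p) p⊓q≡ (m⊓n≤m p q))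

  chain<q : skip (suc g) c < q
  chain<q = <-≤-trans (skip-inc (suc g) c) (subst (_≤ q) p⊓q≡ (m⊓n≤n p q))

  open ChainPromotion c m (skipLabel c (suc g) p q a) (skip (suc g)) (λ _ → refl) refl (λ n _ → skip-inc (suc g) n)
    chain<p chain<q 1<a (λ n n≤c → ≤-trans (skip-mono (suc g) n≤c) (≤-trans (<⇒≤ chain<p) p≤m)) p≤m q≤m a≤m public

  next≡ : ∀ n → n ≤ c → next n ≡ skip (suc g) (suc n)
  next≡ n n≤c with m≤n⇒m<n∨m≡n n≤c
  ... | inj₁ n<c = next-below n<c
  ... | inj₂ refl = trans next-top p⊓q≡

module ShiftPromotion (c m g p q a : ℕ) (p⊓q≡ : p ⊓ q ≡ skip (suc (suc g)) (suc c)) (2≤a : 2 ≤ a)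
  (p≤m : p ≤ m) (q≤m : q ≤ m) (a≤m : a ≤ m) where
  open SkipPromotion c m (suc g) p q a p⊓q≡ 2≤a p≤m q≤m a≤m

  active : next 0 ≤ a
  active = subst (_≤ a) (sym (next≡ 0 z≤n)) 2≤a

  open Active active public using (∂K-u-min; ∂K-u-max; ∂K-v-min; ∂K-v-max)
  open Active active using (∂K-x; ∂K-w-min; ∂K-w-max)

  ∂K-x-shift : ∀ j → ∂K c m (skipLabel c (suc (suc g)) p q a) (x j) ≡ skip (suc g) (toℕ j)
  ∂K-x-shift j = trans (∂K-x j) (cong (_∸ 1) (next≡ (toℕ j) (toℕ≤c j)))

  ∂K-w-wrap : a ≡ 2 → ∂K c m (skipLabel c (suc (suc g)) p q a) w ≡ m
  ∂K-w-wrap a≡2 = ∂K-w-min (≤-reflexive (trans a≡2 (sym (next≡ 0 z≤n))))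

  ∂K-w-down : 2 < a → ∂K c m (skipLabel c (suc (suc g)) p q a) w ≡ a ∸ 1
  ∂K-w-down 2<a = ∂K-w-max (subst (_< a) (sym (next≡ 0 z≤n)) 2<a)

-- The hole left at x 0 is captured by w, which carries the label 2.
module WrapPromotion (c m p q : ℕ) (p⊓q≡ : p ⊓ q ≡ skip 1 (suc c)) (p≤m : p ≤ m) (q≤m : q ≤ m) (2≤m : 2 ≤ m) where
  open SkipPromotion c m 0 p q 2 p⊓q≡ ≤-refl p≤m q≤m 2≤m

  inactive : 2 < next 0
  inactive = subst (2 <_) (sym (next≡ 0 z≤n)) ≤-refl

  open Inactive inactive public using (∂K-u; ∂K-v; ∂K-w)
  open Inactive inactive using (∂K-x₀; ∂K-x)

  ∂K-x-wrap : ∀ j → ∂K c m (skipLabel c 1 p q 2) (x j) ≡ suc (toℕ j)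
  ∂K-x-wrap j with toℕ-cases j
  ... | inj₁ t0 = trans (∂K-x₀ j t0) (cong suc (sym t0))
  ... | inj₂ (n , tn) = trans (∂K-x j n tn) (cong suc (sym tn))

-- Orbits of ∂K from a conjugate dynamics on states

module Transfer (c m : ℕ) {S : Set} (Φ : S → Elem c → ℕ) (f : S → S) (Valid : S → Set)
  (valid-f : ∀ {s} → Valid s → Valid (f s)) (∂K-Φ : ∀ {s} → Valid s → ∂K c m (Φ s) ≗E Φ (f s)) where

  valid-iter : ∀ k {s} → Valid s → Valid (iter f k s)
  valid-iter zero vs = vs
  valid-iter (suc k) vs = valid-f (valid-iter k vs)

  iter-∂K : ∀ k {s} → Valid s → iter (∂K c m) k (Φ s) ≗E Φ (iter f k s)
  iter-∂K zero vs e = refl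
  iter-∂K (suc k) vs e = trans (∂K-cong c m (iter-∂K k vs) e) (∂K-Φ (valid-iter k vs) e)

  orbit-size : ∀ {s} P → Valid s → 0 < P → iter f P s ≡ s →
    (∀ j → 0 < j → j < P → ¬ (Φ (iter f j s) ≗E Φ s)) → OrbitSize c m (Φ s) P
  orbit-size P vs 0<P period minimal =
    0<P , (λ e → trans (iter-∂K P vs e) (cong (λ s → Φ s e) period)) ,
    λ j 0<j j<P back → minimal j 0<j j<P (λ e → trans (sym (iter-∂K j vs e)) (back e))

  same-orbit : ∀ {s L} k → Valid s → Φ (iter f k s) ≗E L → SameOrbit c m (Φ s) L
  same-orbit k vs ≗L = k , λ e → trans (iter-∂K k vs e) (≗L e)

  same-orbit-states : ∀ {s s'} k → Valid s → iter (∂K c m) k (Φ s) ≗E Φ s' → Φ (iter f k s) ≗E Φ s'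
  same-orbit-states k vs ≗s' e = trans (sym (iter-∂K k vs e)) (≗s' e)

module Countdown (t' : ℕ) where
  t : ℕ
  t = suc (suc t')

  InRange : ℕ → Set
  InRange a = 2 ≤ a × a ≤ t

  t-in-range : InRange t
  t-in-range = s≤s (s≤s z≤n) , ≤-refl

  -- The label of w drops by one under ∂K until it reaches 2, after which it wraps around to t.
  countdown : ℕ → ℕ
  countdown (suc (suc (suc a))) = suc (suc a)
  countdown _ = t

  countdown-cases : ∀ {a} → 2 ≤ a → (a ≡ 2 × countdown a ≡ t) ⊎ (2 < a × countdown a ≡ a ∸ 1)
  countdown-cases {suc (suc zero)} _ = inj₁ (refl , refl)
  countdown-cases {suc (suc (suc a))} _ = inj₂ (s≤s (s≤s (s≤s z≤n)) , refl)
  countdown-cases {suc zero} (s≤s ())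

  countdown-in-range : ∀ {a} → InRange a → InRange (countdown a)
  countdown-in-range {suc (suc zero)} _ = t-in-range
  countdown-in-range {suc (suc (suc a))} (_ , a≤t) = s≤s (s≤s z≤n) , ≤-trans (n≤1+n _) a≤t
  countdown-in-range {suc zero} (s≤s () , _)

  n∸k≡1+n∸[1+k] : ∀ {n k} → suc k ≤ n → n ∸ k ≡ suc (n ∸ suc k)
  n∸k≡1+n∸[1+k] = +-∸-assoc 1

  countdown-iter : ∀ k → k ≤ t' → iter countdown k t ≡ 2 + (t' ∸ k)
  countdown-iter zero _ = refl
  countdown-iter (suc k) k<t' rewrite countdown-iter k (<⇒≤ k<t') | n∸k≡1+n∸[1+k] k<t' = refl

  countdown-period : iter countdown (suc t') t ≡ t
  countdown-period rewrite countdown-iter t' ≤-refl | n∸n≡0 t' = refl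

  countdown-reaches : ∀ {a} → InRange a → iter countdown (t ∸ a) t ≡ a
  countdown-reaches {suc (suc r)} (_ , s≤s (s≤s r≤t')) = trans (countdown-iter (t' ∸ r) (m∸n≤m t' r)) (cong (2 +_) (m∸[m∸n]≡n r≤t'))
  countdown-reaches {suc zero} (s≤s () , _)

  countdown-leaves : ∀ j → 0 < j → j ≤ t' → iter countdown j t ≢ t
  countdown-leaves j 0<j j≤t' back = <⇒≢ (∸-monoʳ-< 0<j j≤t') (suc-injective (suc-injective (trans (sym (countdown-iter j j≤t')) back)))

  module OneOrbit (c m : ℕ) (Φ : ℕ → Elem c → ℕ)
    (∂K-Φ : ∀ {a} → InRange a → ∂K c m (Φ a) ≗E Φ (countdown a))
    (Φ-inj : ∀ {a a'} → InRange a → InRange a' → Φ a ≗E Φ a' → a ≡ a') where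
    open Transfer c m Φ countdown InRange countdown-in-range ∂K-Φ

    orbit-of-t : OrbitSize c m (Φ t) (suc t')
    orbit-of-t = orbit-size (suc t') t-in-range (s≤s z≤n) countdown-period λ j 0<j j≤t' back →
      countdown-leaves j 0<j (m<1+n⇒m≤n j≤t') (Φ-inj (valid-iter j t-in-range) t-in-range back)

    in-orbit-of-t : ∀ {a L} → InRange a → Φ a ≗E L → SameOrbit c m (Φ t) L
    in-orbit-of-t {a} va Φa≗L = same-orbit (t ∸ a) t-in-range λ e → trans (cong (λ a → Φ a e) (countdown-reaches va)) (Φa≗L e)

  countdown₂ : ℕ → Bool × ℕ → Bool × ℕ
  countdown₂ f (b , suc (suc (suc a))) = not b , suc (suc a)
  countdown₂ f (b , _) = iter not f b , t

  countdown₂-1 : ∀ b a → countdown₂ 1 (b , a) ≡ (not b , countdown a)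
  countdown₂-1 b zero = refl
  countdown₂-1 b (suc zero) = refl
  countdown₂-1 b (suc (suc zero)) = refl
  countdown₂-1 b (suc (suc (suc a))) = refl

  InRange₂ : Bool × ℕ → Set
  InRange₂ (_ , a) = InRange a

  countdown₂-in-range : ∀ f {s} → InRange₂ s → InRange₂ (countdown₂ f s)
  countdown₂-in-range f {_ , suc (suc zero)} _ = t-in-range
  countdown₂-in-range f {_ , suc (suc (suc a))} (_ , a≤t) = s≤s (s≤s z≤n) , ≤-trans (n≤1+n _) a≤t
  countdown₂-in-range f {_ , suc zero} (s≤s () , _)

  countdown₂-iter : ∀ f k b → k ≤ t' → iter (countdown₂ f) k (b , t) ≡ (iter not k b , 2 + (t' ∸ k))
  countdown₂-iter f zero b _ = refl
  countdown₂-iter f (suc k) b k<t' rewrite countdown₂-iter f k b (<⇒≤ k<t') | n∸k≡1+n∸[1+k] k<t' = refl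

  countdown₂-period : ∀ f b → iter (countdown₂ f) (suc t') (b , t) ≡ (iter not (f + t') b , t)
  countdown₂-period f b rewrite countdown₂-iter f t' b ≤-refl | n∸n≡0 t' | iter-+ not f t' b = refl

  countdown₂-reaches : ∀ f b {a} → InRange a → iter (countdown₂ f) (t ∸ a) (iter not (t ∸ a) b , t) ≡ (b , a)
  countdown₂-reaches f b {suc (suc r)} (_ , s≤s (s≤s r≤t')) =
    trans (countdown₂-iter f (t' ∸ r) _ (m∸n≤m t' r)) (cong₂ _,_ (iter-not-invol (t' ∸ r) b) (cong (2 +_) (m∸[m∸n]≡n r≤t')))
  countdown₂-reaches f b {suc zero} (s≤s () , _)

  countdown₂-leaves : ∀ f j b b' → 0 < j → j ≤ t' → iter (countdown₂ f) j (b , t) ≢ (b' , t)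
  countdown₂-leaves f j b b' 0<j j≤t' back =
    <⇒≢ (∸-monoʳ-< 0<j j≤t') (suc-injective (suc-injective (trans (sym (cong proj₂ (countdown₂-iter f j b j≤t'))) (cong proj₂ back))))

  module FlipOrbits (c m f : ℕ) (Φ : Bool × ℕ → Elem c → ℕ)
    (∂K-Φ : ∀ {s} → InRange₂ s → ∂K c m (Φ s) ≗E Φ (countdown₂ f s))
    (Φ-inj : ∀ {s s'} → InRange₂ s → InRange₂ s' → Φ s ≗E Φ s' → s ≡ s') where
    open Transfer c m Φ (countdown₂ f) InRange₂ (countdown₂-in-range f) ∂K-Φ

    leaves : ∀ {j b b'} → 0 < j → j ≤ t' → ¬ (Φ (iter (countdown₂ f) j (b , t)) ≗E Φ (b' , t))
    leaves {j} 0<j j≤t' back = countdown₂-leaves f j _ _ 0<j j≤t' (Φ-inj (valid-iter j t-in-range) t-in-range back)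

    reaches-from : ∀ {b a L} → InRange a → Φ (b , a) ≗E L → SameOrbit c m (Φ (iter not (t ∸ a) b , t)) L
    reaches-from {b} {a} va Φs≗L =
      same-orbit (t ∸ a) t-in-range λ e → trans (cong (λ s → Φ s e) (countdown₂-reaches f b va)) (Φs≗L e)

    module EvenFlips (even : Even (f + t')) where
      orbit-of : ∀ b → OrbitSize c m (Φ (b , t)) (suc t')
      orbit-of b = orbit-size (suc t') t-in-range (s≤s z≤n)
        (trans (countdown₂-period f b) (cong (_, t) (iter-not-Even even b))) λ j 0<j j≤t' → leaves 0<j (m<1+n⇒m≤n j≤t')

      parity : Bool × ℕ → Bool
      parity (b , a) = iter not a b

      parity-step : ∀ {s} → InRange₂ s → parity (countdown₂ f s) ≡ parity s
      parity-step {b , suc (suc (suc a))} _ = iter-commute not (suc (suc a)) b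
      parity-step {b , suc (suc zero)} _ = begin
        iter not t (iter not f b)            ≡⟨ sym (iter-+ not t f b) ⟩
        not (not (iter not (t' + f) b))      ≡⟨ not-involutive _ ⟩
        iter not (t' + f) b                  ≡⟨ cong (λ n → iter not n b) (+-comm t' f) ⟩
        iter not (f + t') b                  ≡⟨ iter-not-Even even b ⟩
        b                                    ≡⟨ sym (not-involutive b) ⟩
        not (not b)                          ∎
        where open ≡-Reasoning
      parity-step {b , suc zero} (s≤s () , _)

      parity-iter : ∀ k {s} → InRange₂ s → parity (iter (countdown₂ f) k s) ≡ parity s
      parity-iter zero vs = refl
      parity-iter (suc k) vs = trans (parity-step (valid-iter k vs)) (parity-iter k vs)

      separated : ∀ b₀ b₁ → SameOrbit c m (Φ (b₀ , t)) (Φ (b₁ , t)) → b₀ ≡ b₁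
      separated _ _ (k , back) = iter-not-injective t (trans (sym (parity-iter k t-in-range))
        (cong parity (Φ-inj (valid-iter k t-in-range) t-in-range (same-orbit-states k t-in-range back))))

    module OddFlips (odd : Odd (f + t')) where
      half-period : ∀ b → iter (countdown₂ f) (suc t') (b , t) ≡ (not b , t)
      half-period b = trans (countdown₂-period f b) (cong (_, t) (iter-not-Odd odd b))

      period : ∀ b → iter (countdown₂ f) (2 * suc t') (b , t) ≡ (b , t)
      period b = begin
        iter (countdown₂ f) (suc t' + (suc t' + 0)) (b , t)  ≡⟨ cong (λ n → iter (countdown₂ f) (suc t' + n) (b , t)) (+-identityʳ (suc t')) ⟩
        iter (countdown₂ f) (suc t' + suc t') (b , t)        ≡⟨ iter-+ (countdown₂ f) (suc t') (suc t') (b , t) ⟩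
        iter (countdown₂ f) (suc t') (iter (countdown₂ f) (suc t') (b , t))
                                                              ≡⟨ cong (iter (countdown₂ f) (suc t')) (half-period b) ⟩
        iter (countdown₂ f) (suc t') (not b , t)             ≡⟨ trans (half-period (not b)) (cong (_, t) (not-involutive b)) ⟩
        (b , t)                                               ∎
        where open ≡-Reasoning

      orbit-of : ∀ b → OrbitSize c m (Φ (b , t)) (2 * suc t')
      orbit-of b = orbit-size (2 * suc t') t-in-range (s≤s z≤n) (period b) minimal
        where
        minimal : ∀ j → 0 < j → j < 2 * suc t' → ¬ (Φ (iter (countdown₂ f) j (b , t)) ≗E Φ (b , t))
        minimal j 0<j j<2P back with <-cmp j (suc t')
        ... | tri< j<P _ _ = leaves 0<j (m<1+n⇒m≤n j<P) back
        ... | tri≈ _ refl _ = not-¬ refl (sym (cong proj₁ (Φ-inj t-in-range t-in-range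
                                (λ e → trans (cong (λ s → Φ s e) (sym (half-period b))) (back e)))))
        ... | tri> _ _ P<j = leaves {j ∸ suc t'} (m<n⇒0<n∸m P<j) j-P≤t' λ e → trans (cong (λ s → Φ s e) (sym shifted)) (back e)
          where
          j-P≤t' : j ∸ suc t' ≤ t'
          j-P≤t' = m<1+n⇒m≤n (m<n+o⇒m∸n<o j (suc t') (subst (j <_) (cong (suc t' +_) (+-identityʳ (suc t'))) j<2P))
          shifted : iter (countdown₂ f) j (b , t) ≡ iter (countdown₂ f) (j ∸ suc t') (not b , t)
          shifted = begin
            iter (countdown₂ f) j (b , t)  ≡⟨ cong (λ n → iter (countdown₂ f) n (b , t)) (sym (m∸n+n≡m (<⇒≤ P<j))) ⟩
            iter (countdown₂ f) (j ∸ suc t' + suc t') (b , t)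
              ≡⟨ iter-+ (countdown₂ f) (j ∸ suc t') (suc t') (b , t) ⟩
            iter (countdown₂ f) (j ∸ suc t') (iter (countdown₂ f) (suc t') (b , t))
              ≡⟨ cong (iter (countdown₂ f) (j ∸ suc t')) (half-period b) ⟩
            iter (countdown₂ f) (j ∸ suc t') (not b , t) ∎
            where open ≡-Reasoning

      in-orbit-of : ∀ b {b₁ a L} → InRange a → Φ (b₁ , a) ≗E L → SameOrbit c m (Φ (b , t)) L
      in-orbit-of b {b₁} {a} va Φs≗L with iter not (t ∸ a) b₁ ≟ᵇ b
      ... | yes refl = reaches-from va Φs≗L
      ... | no b'≢b = same-orbit (t ∸ a + suc t') t-in-range λ e → trans (cong (λ s → Φ s e) via-not) (Φs≗L e)
        where
        via-not : iter (countdown₂ f) (t ∸ a + suc t') (b , t) ≡ (b₁ , a)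
        via-not = begin
          iter (countdown₂ f) (t ∸ a + suc t') (b , t)  ≡⟨ iter-+ (countdown₂ f) (t ∸ a) (suc t') (b , t) ⟩
          iter (countdown₂ f) (t ∸ a) (iter (countdown₂ f) (suc t') (b , t))
                                                        ≡⟨ cong (iter (countdown₂ f) (t ∸ a)) (half-period b) ⟩
          iter (countdown₂ f) (t ∸ a) (not b , t)       ≡⟨ cong (λ b' → iter (countdown₂ f) (t ∸ a) (b' , t)) (sym (¬-not b'≢b)) ⟩
          iter (countdown₂ f) (t ∸ a) (iter not (t ∸ a) b₁ , t) ≡⟨ countdown₂-reaches f b₁ va ⟩
          (b₁ , a)                                      ∎
          where open ≡-Reasoning

bit : Fin 2 → Bool
bit Fin.zero = true
bit (Fin.suc _) = false

index : Bool → Fin 2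
index true = Fin.zero
index false = Fin.suc Fin.zero

bit-index : ∀ b → bit (index b) ≡ b
bit-index true = refl
bit-index false = refl

bit-injective : ∀ {i j} → bit i ≡ bit j → i ≡ j
bit-injective {Fin.zero} {Fin.zero} _ = refl
bit-injective {Fin.suc Fin.zero} {Fin.suc Fin.zero} _ = refl
bit-injective {Fin.zero} {Fin.suc _} ()
bit-injective {Fin.suc _} {Fin.zero} ()

-- The shape of a labeling

pick : Bool → ℕ → ℕ → ℕ
pick true lo hi = lo
pick false lo hi = hi

pick-⊓ : ∀ b {lo hi} → lo ≤ hi → pick b lo hi ⊓ pick (not b) lo hi ≡ lo
pick-⊓ true lo≤hi = m≤n⇒m⊓n≡m lo≤hi
pick-⊓ false lo≤hi = m≥n⇒m⊓n≡n lo≤hi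

pick-map : ∀ (f : ℕ → ℕ) b {lo hi} → f (pick b lo hi) ≡ pick b (f lo) (f hi)
pick-map f true = refl
pick-map f false = refl

pick-≤ : ∀ b {lo hi k} → lo ≤ k → hi ≤ k → pick b lo hi ≤ k
pick-≤ true lo≤k _ = lo≤k
pick-≤ false _ hi≤k = hi≤k

pick-≥ : ∀ b {lo hi k} → k ≤ lo → k ≤ hi → k ≤ pick b lo hi
pick-≥ true k≤lo _ = k≤lo
pick-≥ false _ k≤hi = k≤hi

pick-distinct : ∀ b {lo hi} → lo ≢ hi → pick b lo hi ≢ pick (not b) lo hi
pick-distinct true lo≢hi = lo≢hi
pick-distinct false lo≢hi = ≢-sym lo≢hi

pick-injective : ∀ {b b' lo hi} → lo ≢ hi → pick b lo hi ≡ pick b' lo hi → b ≡ b'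
pick-injective {true} {true} _ _ = refl
pick-injective {false} {false} _ _ = refl
pick-injective {true} {false} lo≢hi lo≡hi = ⊥-elim (lo≢hi lo≡hi)
pick-injective {false} {true} lo≢hi hi≡lo = ⊥-elim (lo≢hi (sym hi≡lo))

-- Under ∂K the smaller of the two top labels becomes m and the larger drops by one.
pick-promoted-u : ∀ b {lo hi m X} → lo < hi →
  (pick b lo hi ≤ pick (not b) lo hi → X ≡ m) → (pick (not b) lo hi < pick b lo hi → X ≡ pick b lo hi ∸ 1) →
  X ≡ pick (not b) (hi ∸ 1) m
pick-promoted-u true lo<hi smaller _ = smaller (<⇒≤ lo<hi)
pick-promoted-u false lo<hi _ larger = larger lo<hi

pick-promoted-v : ∀ b {lo hi m X} → lo < hi →
  (pick (not b) lo hi ≤ pick b lo hi → X ≡ m) → (pick b lo hi < pick (not b) lo hi → X ≡ pick (not b) lo hi ∸ 1) →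
  X ≡ pick (not (not b)) (hi ∸ 1) m
pick-promoted-v true lo<hi _ larger = larger lo<hi
pick-promoted-v false lo<hi smaller _ = smaller (<⇒≤ lo<hi)

pick-cover : ∀ {p q lo hi} → lo ≢ hi → p ≡ lo ⊎ q ≡ lo → p ≡ hi ⊎ q ≡ hi → ∃ λ b → p ≡ pick b lo hi × q ≡ pick (not b) lo hi
pick-cover lo≢hi (inj₁ p≡lo) (inj₁ p≡hi) = ⊥-elim (lo≢hi (trans (sym p≡lo) p≡hi))
pick-cover lo≢hi (inj₁ p≡lo) (inj₂ q≡hi) = true , p≡lo , q≡hi
pick-cover lo≢hi (inj₂ q≡lo) (inj₁ p≡hi) = false , p≡hi , q≡lo
pick-cover lo≢hi (inj₂ q≡lo) (inj₂ q≡hi) = ⊥-elim (lo≢hi (trans (sym q≡lo) q≡hi))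

pick-lo : ∀ b {lo hi} → pick b lo hi ≡ lo ⊎ pick (not b) lo hi ≡ lo
pick-lo true = inj₁ refl
pick-lo false = inj₂ refl

pick-hi : ∀ b {lo hi} → pick b lo hi ≡ hi ⊎ pick (not b) lo hi ≡ hi
pick-hi true = inj₂ refl
pick-hi false = inj₁ refl

two-cannot-cover-three : ∀ {p q k₁ k₂ k₃} → k₁ < k₂ → k₂ < k₃ →
  p ≡ k₁ ⊎ q ≡ k₁ → p ≡ k₂ ⊎ q ≡ k₂ → p ≡ k₃ ⊎ q ≡ k₃ → ⊥
two-cannot-cover-three k₁<k₂ k₂<k₃ (inj₁ refl) (inj₁ refl) _ = <-irrefl refl k₁<k₂
two-cannot-cover-three k₁<k₂ k₂<k₃ (inj₂ refl) (inj₂ refl) _ = <-irrefl refl k₁<k₂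
two-cannot-cover-three k₁<k₂ k₂<k₃ _ (inj₁ refl) (inj₁ refl) = <-irrefl refl k₂<k₃
two-cannot-cover-three k₁<k₂ k₂<k₃ _ (inj₂ refl) (inj₂ refl) = <-irrefl refl k₂<k₃
two-cannot-cover-three k₁<k₂ k₂<k₃ (inj₁ refl) (inj₂ refl) (inj₁ refl) = <-irrefl refl (<-trans k₁<k₂ k₂<k₃)
two-cannot-cover-three k₁<k₂ k₂<k₃ (inj₂ refl) (inj₁ refl) (inj₂ refl) = <-irrefl refl (<-trans k₁<k₂ k₂<k₃)

module Classify (c m : ℕ) (L : Elem c → ℕ) (isLabeling : IsLabeling c m L) where
  private
    bounds : ∀ e → 1 ≤ L e × L e ≤ m
    bounds = proj₁ isLabeling
    onto : ∀ k → 1 ≤ k → k ≤ m → ∃ λ e → L e ≡ k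
    onto = proj₁ (proj₂ isLabeling)
    monotone : ∀ a b → a <T b → L a < L b
    monotone = proj₂ (proj₂ isLabeling)

  ℓ : ℕ → ℕ
  ℓ n = L (x (fromℕ-clamped c n))

  L-x : ∀ j → L (x j) ≡ ℓ (toℕ j)
  L-x j = cong (L ∘ x) (sym (fromℕ-clamped-toℕ j))

  ≤m : ∀ e → L e ≤ m
  ≤m e = proj₂ (bounds e)

  ℓ-mono : ∀ {n n'} → n < n' → n' ≤ c → ℓ n < ℓ n'
  ℓ-mono {n} {n'} n<n' n'≤c = monotone _ _ (x<x (subst₂ _<_ (sym (toℕ-fromℕ-clamped c n (≤-trans (<⇒≤ n<n') n'≤c)))
                                                             (sym (toℕ-fromℕ-clamped c n' n'≤c)) n<n'))

  ℓ-mono-≤ : ∀ {n n'} → n ≤ n' → n' ≤ c → ℓ n ≤ ℓ n'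
  ℓ-mono-≤ n≤n' n'≤c with m≤n⇒m<n∨m≡n n≤n'
  ... | inj₁ n<n' = <⇒≤ (ℓ-mono n<n' n'≤c)
  ... | inj₂ refl = ≤-refl

  ℓ<u : ∀ n → ℓ n < L u
  ℓ<u n = monotone _ _ x<u

  ℓ<v : ∀ n → ℓ n < L v
  ℓ<v n = monotone _ _ x<v

  ℓ-0 : ℓ 0 ≡ 1
  ℓ-0 with onto 1 ≤-refl (≤-trans (proj₁ (bounds w)) (≤m w))
  ... | e , Le≡1 = ≤-antisym (subst (ℓ 0 ≤_) Le≡1 (x₀-least e)) (proj₁ (bounds (x Fin.zero)))
    where
    x₀-least : ∀ e → ℓ 0 ≤ L e
    x₀-least (x Fin.zero) = ≤-refl
    x₀-least (x (Fin.suc j)) = <⇒≤ (monotone _ _ (x<x (s≤s z≤n)))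
    x₀-least u = <⇒≤ (monotone _ _ x<u)
    x₀-least v = <⇒≤ (monotone _ _ x<v)
    x₀-least w = <⇒≤ (monotone _ _ (x<w refl))

  1<w : 1 < L w
  1<w = subst (_< L w) ℓ-0 (monotone _ _ (x<w refl))

  only-w-between : ∀ {n k} → n < c → ℓ n < k → k < ℓ (suc n) → L w ≡ k
  only-w-between {n} {k} n<c ℓ<k k<ℓ with onto k (≤-trans (s≤s z≤n) ℓ<k) (≤-trans (<⇒≤ k<ℓ) (≤m _))
  ... | x j , Lj≡k with toℕ j ≤? n
  ...   | yes j≤n = ⊥-elim (<⇒≱ ℓ<k (subst (_≤ ℓ n) (trans (sym (L-x j)) Lj≡k) (ℓ-mono-≤ j≤n (<⇒≤ n<c))))
  ...   | no j≰n = ⊥-elim (<⇒≱ k<ℓ (subst (ℓ (suc n) ≤_) (trans (sym (L-x j)) Lj≡k) (ℓ-mono-≤ (≰⇒> j≰n) (toℕ≤c j))))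
  only-w-between n<c ℓ<k k<ℓ | u , Lu≡k = ⊥-elim (<-asym k<ℓ (subst (ℓ _ <_) Lu≡k (ℓ<u _)))
  only-w-between n<c ℓ<k k<ℓ | v , Lv≡k = ⊥-elim (<-asym k<ℓ (subst (ℓ _ <_) Lv≡k (ℓ<v _)))
  only-w-between n<c ℓ<k k<ℓ | w , Lw≡k = Lw≡k

  chain-step : ∀ n → n < c → ℓ (suc n) ≡ suc (ℓ n) ⊎ (ℓ (suc n) ≡ suc (suc (ℓ n)) × L w ≡ suc (ℓ n))
  chain-step n n<c with ℓ (suc n) ≟ suc (ℓ n) | ℓ (suc n) ≟ suc (suc (ℓ n))
  ... | yes ℓ≡ | _ = inj₁ ℓ≡
  ... | no _ | yes ℓ≡ = inj₂ (ℓ≡ , only-w-between n<c ≤-refl (subst (suc (ℓ n) <_) (sym ℓ≡) ≤-refl))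
  ... | no ℓ≢1+ | no ℓ≢2+ = ⊥-elim (1+n≢n (trans (sym (only-w-between n<c (<-trans (n<1+n _) (n<1+n _)) 2+<ℓ))
                                                 (only-w-between n<c (n<1+n _) (<-trans (n<1+n _) 2+<ℓ))))
    where
    2+<ℓ : suc (suc (ℓ n)) < ℓ (suc n)
    2+<ℓ = ≤∧≢⇒< (≤∧≢⇒< (ℓ-mono (n<1+n n) n<c) (≢-sym ℓ≢1+)) (≢-sym ℓ≢2+)

  data ChainShape (n : ℕ) : Set where
    consecutive : (∀ n' → n' ≤ n → ℓ n' ≡ suc n') → ChainShape n
    gap-at-w : 2 ≤ L w → L w ≤ suc n → (∀ n' → n' ≤ n → ℓ n' ≡ skip (L w ∸ 1) n') → ChainShape n

  private
    up-to-suc : ∀ {P : ℕ → Set} {n} → (∀ n' → n' ≤ n → P n') → P (suc n) → ∀ n' → n' ≤ suc n → P n'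
    up-to-suc below top n' n'≤ with ≤1+⇒≤∨≡ n'≤
    ... | inj₁ n'≤n = below n' n'≤n
    ... | inj₂ refl = top

  gap-top : ∀ {n} → L w ≤ suc n → (∀ n' → n' ≤ n → ℓ n' ≡ skip (L w ∸ 1) n') → ℓ n ≡ suc (suc n)
  gap-top w≤1+n ℓ≡ = trans (ℓ≡ _ ≤-refl) (skip-≥ (∸-monoˡ-≤ 1 w≤1+n))

  chain-shape : ∀ n → n ≤ c → ChainShape n
  chain-shape zero _ = consecutive λ { zero _ → ℓ-0 }
  chain-shape (suc n) n<c with chain-shape n (<⇒≤ n<c) | chain-step n n<c
  ... | consecutive ℓ≡ | inj₁ ℓ'≡ = consecutive (up-to-suc ℓ≡ (trans ℓ'≡ (cong suc (ℓ≡ n ≤-refl))))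
  ... | consecutive ℓ≡ | inj₂ (ℓ'≡ , w≡) = gap-at-w (subst (2 ≤_) (sym w≡') (s≤s (s≤s z≤n))) (≤-reflexive w≡')
        (up-to-suc (λ n' n'≤n → trans (ℓ≡ n' n'≤n) (sym (trans (cong (λ a → skip (a ∸ 1) n') w≡') (skip-< (s≤s n'≤n)))))
                   (trans ℓ'≡ (trans (cong (suc ∘ suc) (ℓ≡ n ≤-refl)) (sym (trans (cong (λ a → skip (a ∸ 1) (suc n)) w≡') (skip-≥ ≤-refl))))))
    where
    w≡' : L w ≡ suc (suc n)
    w≡' = trans w≡ (cong suc (ℓ≡ n ≤-refl))
  ... | gap-at-w 2≤w w≤1+n ℓ≡ | inj₁ ℓ'≡ = gap-at-w 2≤w (m≤n⇒m≤1+n w≤1+n)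
        (up-to-suc ℓ≡ (trans ℓ'≡ (trans (cong suc (trans (ℓ≡ n ≤-refl) (skip-≥ g≤n))) (sym (skip-≥ (m≤n⇒m≤1+n g≤n))))))
    where
    g≤n : L w ∸ 1 ≤ n
    g≤n = ∸-monoˡ-≤ 1 w≤1+n
  ... | gap-at-w 2≤w w≤1+n ℓ≡ | inj₂ (_ , w≡) =
        ⊥-elim (<⇒≱ (s≤s (s≤s (n≤1+n n))) (subst (_≤ suc n) (trans w≡ (cong suc (gap-top w≤1+n ℓ≡))) w≤1+n))

  above-chain : ∀ {k} → ℓ c < k → k ≤ m → L u ≡ k ⊎ L v ≡ k ⊎ L w ≡ k
  above-chain {k} ℓ<k k≤m with onto k (≤-trans (s≤s z≤n) ℓ<k) k≤m
  ... | x j , Lj≡k = ⊥-elim (<⇒≱ ℓ<k (subst (_≤ ℓ c) (trans (sym (L-x j)) Lj≡k) (ℓ-mono-≤ (toℕ≤c j) ≤-refl)))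
  ... | u , Lu≡k = inj₁ Lu≡k
  ... | v , Lv≡k = inj₂ (inj₁ Lv≡k)
  ... | w , Lw≡k = inj₂ (inj₂ Lw≡k)

  hit-by-u-or-v : ∀ {k} → ℓ c < k → k ≤ m → L w ≢ k → L u ≡ k ⊎ L v ≡ k
  hit-by-u-or-v ℓ<k k≤m w≢k with above-chain ℓ<k k≤m
  ... | inj₁ u≡k = inj₁ u≡k
  ... | inj₂ (inj₁ v≡k) = inj₂ v≡k
  ... | inj₂ (inj₂ w≡k) = ⊥-elim (w≢k w≡k)

  skipLabel-≗ : ∀ {g p q a} → (∀ n → n ≤ c → ℓ n ≡ skip g n) → L u ≡ p → L v ≡ q → L w ≡ a → skipLabel c g p q a ≗E L
  skipLabel-≗ ℓ≡ u≡ v≡ w≡ (x j) = sym (trans (L-x j) (ℓ≡ (toℕ j) (toℕ≤c j)))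
  skipLabel-≗ ℓ≡ u≡ v≡ w≡ u = sym u≡
  skipLabel-≗ ℓ≡ u≡ v≡ w≡ v = sym v≡
  skipLabel-≗ ℓ≡ u≡ v≡ w≡ w = sym w≡

consecutive-isLabeling : ∀ c m {g p q a} → c < g → suc c < p → p ≤ m → suc c < q → q ≤ m → 1 < a → a ≤ m →
  (∀ k → suc c < k → k ≤ m → p ≡ k ⊎ q ≡ k ⊎ a ≡ k) → IsLabeling c m (skipLabel c g p q a)
consecutive-isLabeling c m {g} {p} {q} {a} c<g c<p p≤m c<q q≤m 1<a a≤m above = bounds , onto , monotone
  where
  L : Elem c → ℕ
  L = skipLabel c g p q a
  chain : ∀ j → L (x j) ≡ suc (toℕ j)
  chain j = skip-< (≤-<-trans (toℕ≤c j) c<g)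
  chain<p : ∀ j → L (x j) < p
  chain<p j = subst (_< p) (sym (chain j)) (≤-<-trans (s≤s (toℕ≤c j)) c<p)
  chain<q : ∀ j → L (x j) < q
  chain<q j = subst (_< q) (sym (chain j)) (≤-<-trans (s≤s (toℕ≤c j)) c<q)
  bounds : ∀ e → 1 ≤ L e × L e ≤ m
  bounds (x j) = subst (1 ≤_) (sym (chain j)) (s≤s z≤n) , ≤-trans (<⇒≤ (chain<p j)) p≤m
  bounds u = <⇒≤ (≤-<-trans (s≤s z≤n) c<p) , p≤m
  bounds v = <⇒≤ (≤-<-trans (s≤s z≤n) c<q) , q≤m
  bounds w = <⇒≤ 1<a , a≤m
  onto : ∀ k → 1 ≤ k → k ≤ m → ∃ λ e → L e ≡ k
  onto (suc k) _ k<m with k ≤? c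
  ... | yes k≤c = x (fromℕ-clamped c k) , trans (chain _) (cong suc (toℕ-fromℕ-clamped c k k≤c))
  ... | no k≰c with above (suc k) (s≤s (≰⇒> k≰c)) k<m
  ...   | inj₁ p≡ = u , p≡
  ...   | inj₂ (inj₁ q≡) = v , q≡
  ...   | inj₂ (inj₂ a≡) = w , a≡
  monotone : ∀ e e' → e <T e' → L e < L e'
  monotone (x i) (x j) (x<x i<j) = subst₂ _<_ (sym (chain i)) (sym (chain j)) (s≤s i<j)
  monotone (x i) u x<u = chain<p i
  monotone (x i) v x<v = chain<q i
  monotone (x i) w (x<w i≡0) = subst (_< a) (sym (trans (chain i) (cong suc i≡0))) 1<a

module CaseA (c : ℕ) where
  open Countdown c

  Φ : ℕ → Elem c → ℕ
  Φ = skipLabel c (suc (suc c)) t t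

  ∂K-Φ : ∀ {a} → InRange a → ∂K c t (Φ a) ≗E Φ (countdown a)
  ∂K-Φ {a} (2≤a , a≤t) = promoted
    where
    open ShiftPromotion c t c t t a (trans (⊓-idem t) (sym (skip-< ≤-refl))) 2≤a ≤-refl ≤-refl a≤t
    promoted : ∂K c t (Φ a) ≗E Φ (countdown a)
    promoted (x j) = trans (∂K-x-shift j) (skip-consecutive (s≤s (toℕ≤c j)) (m≤n⇒m≤1+n (s≤s (toℕ≤c j))))
    promoted u = ∂K-u-min ≤-refl
    promoted v = ∂K-v-min ≤-refl
    promoted w with countdown-cases 2≤a
    ... | inj₁ (a≡2 , cd≡) = trans (∂K-w-wrap a≡2) (sym cd≡)
    ... | inj₂ (2<a , cd≡) = trans (∂K-w-down 2<a) (sym cd≡)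

  open OneOrbit c t Φ ∂K-Φ (λ _ _ Φa≗Φa' → Φa≗Φa' w)

  Φt-isLabeling : IsLabeling c t (Φ t)
  Φt-isLabeling = consecutive-isLabeling c t (m≤n⇒m≤1+n ≤-refl) ≤-refl ≤-refl ≤-refl ≤-refl (s≤s (s≤s z≤n)) ≤-refl
    λ k c<k k≤t → inj₁ (≤-antisym c<k k≤t)

  classify : ∀ L → IsLabeling c t L → ∃ λ a → InRange a × Φ a ≗E L
  classify L isL = from-shape (chain-shape c ≤-refl)
    where
    open Classify c t L isL
    from-shape : ChainShape c → ∃ λ a → InRange a × Φ a ≗E L
    from-shape (gap-at-w _ w≤1+c ℓ≡) = ⊥-elim (<⇒≱ (subst (_< L u) (gap-top w≤1+c ℓ≡) (ℓ<u c)) (≤m u))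
    from-shape (consecutive ℓ≡) = L w , (1<w , ≤m w) ,
      skipLabel-≗ (λ n n≤c → trans (ℓ≡ n n≤c) (sym (skip-< (m≤n⇒m≤1+n (s≤s n≤c))))) (top (ℓ<u c)) (top (ℓ<v c)) refl
      where
      top : ∀ {e} → ℓ c < L e → L e ≡ t
      top {e} ℓc<e = ≤-antisym (≤m e) (subst (_< L e) (ℓ≡ c ≤-refl) ℓc<e)

  orbits : OrbitsAre c t 1 (λ _ → suc c)
  orbits = (λ _ → Φ t , Φt-isLabeling) , (λ _ → orbit-of-t) , (λ { Fin.zero Fin.zero _ → refl }) ,
    λ L isL → let (a , va , Φa≗L) = classify L isL in Fin.zero , in-orbit-of-t va Φa≗L

module CaseB (c : ℕ) where
  open Countdown (suc c)

  -- Labelings whose chain is 1, …, c + 1, with u and v carrying c + 2 and c + 3 in some order.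
  ΦA : Bool × ℕ → Elem c → ℕ
  ΦA (b , a) = skipLabel c (suc (suc c)) (pick b (suc (suc c)) t) (pick (not b) (suc (suc c)) t) a

  -- Labelings where u and v carry the same label, the next one above the chain.
  top : ℕ → ℕ
  top a = skip (a ∸ 1) (suc c)

  ΦB : ℕ → Elem c → ℕ
  ΦB a = skipLabel c (a ∸ 1) (top a) (top a) a

  ∂K-ΦA : ∀ {s} → InRange₂ s → ∂K c t (ΦA s) ≗E ΦA (countdown₂ 1 s)
  ∂K-ΦA {b , a} (2≤a , a≤t) e = trans (promoted e) (cong (λ s → ΦA s e) (sym (countdown₂-1 b a)))
    where
    open ShiftPromotion c t c _ _ a (trans (pick-⊓ b (n≤1+n _)) (sym (skip-< ≤-refl))) 2≤a
      (pick-≤ b (n≤1+n _) ≤-refl) (pick-≤ (not b) (n≤1+n _) ≤-refl) a≤t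
    promoted : ∂K c t (ΦA (b , a)) ≗E ΦA (not b , countdown a)
    promoted (x j) = trans (∂K-x-shift j) (skip-consecutive (s≤s (toℕ≤c j)) (m≤n⇒m≤1+n (s≤s (toℕ≤c j))))
    promoted u = pick-promoted-u b ≤-refl ∂K-u-min ∂K-u-max
    promoted v = pick-promoted-v b ≤-refl ∂K-v-min ∂K-v-max
    promoted w with countdown-cases 2≤a
    ... | inj₁ (a≡2 , cd≡) = trans (∂K-w-wrap a≡2) (sym cd≡)
    ... | inj₂ (2<a , cd≡) = trans (∂K-w-down 2<a) (sym cd≡)

  ΦA-inj : ∀ {s s'} → InRange₂ s → InRange₂ s' → ΦA s ≗E ΦA s' → s ≡ s'
  ΦA-inj {b , a} _ _ ΦAs≗ΦAs' with ΦAs≗ΦAs' w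
  ... | refl = cong (_, a) (pick-injective (<⇒≢ ≤-refl) (ΦAs≗ΦAs' u))

  top≤t : ∀ a → top a ≤ t
  top≤t a = skip-≤ (a ∸ 1) (suc c)

  ∂K-ΦB-wrap : ∂K c t (ΦB 2) ≗E ΦB t
  ∂K-ΦB-wrap = promoted
    where
    open WrapPromotion c t (top 2) (top 2) (⊓-idem (top 2)) (top≤t 2) (top≤t 2) (s≤s (s≤s z≤n))
    top≡ : top 2 ∸ 1 ≡ top t
    top≡ = sym (skip-< ≤-refl)
    promoted : ∂K c t (ΦB 2) ≗E ΦB t
    promoted (x j) = trans (∂K-x-wrap j) (sym (skip-< (m≤n⇒m≤1+n (s≤s (toℕ≤c j)))))
    promoted u = trans ∂K-u top≡
    promoted v = trans ∂K-v top≡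
    promoted w = ∂K-w

  ∂K-ΦB-down : ∀ a → suc (suc (suc a)) ≤ t → ∂K c t (ΦB (suc (suc (suc a)))) ≗E ΦB (suc (suc a))
  ∂K-ΦB-down a a<t = promoted
    where
    open ShiftPromotion c t a _ _ (suc (suc (suc a))) (⊓-idem (top (suc (suc (suc a))))) (s≤s (s≤s z≤n))
      (top≤t (suc (suc (suc a)))) (top≤t (suc (suc (suc a)))) a<t
    top≡t : top (suc (suc a)) ≡ t
    top≡t = skip-≥ (s≤s (≤-pred (≤-pred (≤-pred a<t))))
    promoted : ∂K c t (ΦB (suc (suc (suc a)))) ≗E ΦB (suc (suc a))
    promoted (x j) = ∂K-x-shift j
    promoted u = trans (∂K-u-min ≤-refl) (sym top≡t)
    promoted v = trans (∂K-v-min ≤-refl) (sym top≡t)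
    promoted w = ∂K-w-down (s≤s (s≤s (s≤s z≤n)))

  ∂K-ΦB : ∀ {a} → InRange a → ∂K c t (ΦB a) ≗E ΦB (countdown a)
  ∂K-ΦB {suc (suc zero)} _ = ∂K-ΦB-wrap
  ∂K-ΦB {suc (suc (suc a))} (_ , a<t) = ∂K-ΦB-down a a<t
  ∂K-ΦB {suc zero} (s≤s () , _)

  ΦAt-isLabeling : ∀ b → IsLabeling c t (ΦA (b , t))
  ΦAt-isLabeling b = consecutive-isLabeling c t (m≤n⇒m≤1+n (n<1+n c)) (pick-≥ b ≤-refl (n≤1+n _)) (pick-≤ b (n≤1+n _) ≤-refl)
    (pick-≥ (not b) ≤-refl (n≤1+n _)) (pick-≤ (not b) (n≤1+n _) ≤-refl) (s≤s (s≤s z≤n)) ≤-refl above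
    where
    above : ∀ k → suc c < k → k ≤ t → pick b (suc (suc c)) t ≡ k ⊎ pick (not b) (suc (suc c)) t ≡ k ⊎ t ≡ k
    above k c<k k≤t with one-of-two c<k k≤t | pick-lo b
    ... | inj₁ k≡ | inj₁ lo≡ = inj₁ (trans lo≡ (sym k≡))
    ... | inj₁ k≡ | inj₂ lo≡ = inj₂ (inj₁ (trans lo≡ (sym k≡)))
    ... | inj₂ k≡ | _ = inj₂ (inj₂ (sym k≡))

  ΦBt-isLabeling : IsLabeling c t (ΦB t)
  ΦBt-isLabeling = consecutive-isLabeling c t (m≤n⇒m≤1+n (n<1+n c)) c<top (top≤t t) c<top (top≤t t) (s≤s (s≤s z≤n)) ≤-refl above
    where
    top≡ : top t ≡ suc (suc c)
    top≡ = skip-< ≤-refl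
    c<top : suc c < top t
    c<top = ≤-reflexive (sym top≡)
    above : ∀ k → suc c < k → k ≤ t → top t ≡ k ⊎ top t ≡ k ⊎ t ≡ k
    above k c<k k≤t with one-of-two c<k k≤t
    ... | inj₁ k≡ = inj₁ (trans top≡ (sym k≡))
    ... | inj₂ k≡ = inj₂ (inj₂ (sym k≡))

  Classified : (Elem c → ℕ) → Set
  Classified L = (∃ λ s → InRange₂ s × ΦA s ≗E L) ⊎ (∃ λ a → InRange a × ΦB a ≗E L)

  module _ (L : Elem c → ℕ) (isL : IsLabeling c t L) where
    open Classify c t L isL

    w-in-range : InRange (L w)
    w-in-range = 1<w , ≤m w

    classify-gap : L w ≤ suc c → (∀ n → n ≤ c → ℓ n ≡ skip (L w ∸ 1) n) → Classified L
    classify-gap w≤1+c ℓ≡ = inj₂ (L w , w-in-range , skipLabel-≗ ℓ≡ (at-top u (ℓ<u c)) (at-top v (ℓ<v c)) refl)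
      where
      top≡t : top (L w) ≡ t
      top≡t = skip-≥ (m≤n⇒m≤1+n (∸-monoˡ-≤ 1 w≤1+c))
      at-top : ∀ e → ℓ c < L e → L e ≡ top (L w)
      at-top e ℓc<e = trans (≤-antisym (≤m e) (subst (_< L e) (gap-top w≤1+c ℓ≡) ℓc<e)) (sym top≡t)

    module Consecutive (ℓ≡ : ∀ n → n ≤ c → ℓ n ≡ suc n) where
      chain : ∀ {g} → suc c ≤ g → ∀ n → n ≤ c → ℓ n ≡ skip g n
      chain c<g n n≤c = trans (ℓ≡ n n≤c) (sym (skip-< (≤-<-trans n≤c c<g)))

      top-label : ∀ e → ℓ c < L e → L e ≡ suc (suc c) ⊎ L e ≡ t
      top-label e ℓc<e = one-of-two (subst (_< L e) (ℓ≡ c ≤-refl) ℓc<e) (≤m e)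

      w-fills : ∀ {k} → L u ≢ k → L v ≢ k → suc c < k → k ≤ t → L w ≡ k
      w-fills u≢k v≢k c<k k≤t with above-chain (subst (_< _) (sym (ℓ≡ c ≤-refl)) c<k) k≤t
      ... | inj₁ u≡k = ⊥-elim (u≢k u≡k)
      ... | inj₂ (inj₁ v≡k) = ⊥-elim (v≢k v≡k)
      ... | inj₂ (inj₂ w≡k) = w≡k

      c+2≢t : suc (suc c) ≢ t
      c+2≢t = <⇒≢ ≤-refl

      from-tops : L u ≡ suc (suc c) ⊎ L u ≡ t → L v ≡ suc (suc c) ⊎ L v ≡ t → Classified L
      from-tops (inj₁ u≡) (inj₂ v≡) = inj₁ ((true , L w) , w-in-range , skipLabel-≗ (chain (n≤1+n _)) u≡ v≡ refl)
      from-tops (inj₂ u≡) (inj₁ v≡) = inj₁ ((false , L w) , w-in-range , skipLabel-≗ (chain (n≤1+n _)) u≡ v≡ refl)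
      from-tops (inj₁ u≡) (inj₁ v≡) = inj₂ (t , t-in-range , skipLabel-≗ (chain (n≤1+n _)) (trans u≡ (sym top≡)) (trans v≡ (sym top≡)) w≡t)
        where
        top≡ : top t ≡ suc (suc c)
        top≡ = skip-< ≤-refl
        w≡t : L w ≡ t
        w≡t = w-fills (λ u≡t → c+2≢t (trans (sym u≡) u≡t)) (λ v≡t → c+2≢t (trans (sym v≡) v≡t)) (s≤s (n≤1+n _)) ≤-refl
      from-tops (inj₂ u≡) (inj₂ v≡) =
        inj₂ (suc (suc c) , (s≤s (s≤s z≤n) , n≤1+n _) , skipLabel-≗ (chain ≤-refl) (trans u≡ (sym top≡)) (trans v≡ (sym top≡)) w≡)
        where
        top≡ : top (suc (suc c)) ≡ t
        top≡ = skip-≥ ≤-refl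
        w≡ : L w ≡ suc (suc c)
        w≡ = w-fills (λ u≡c+2 → c+2≢t (trans (sym u≡c+2) u≡)) (λ v≡c+2 → c+2≢t (trans (sym v≡c+2) v≡)) ≤-refl (n≤1+n _)

      classify-consecutive : Classified L
      classify-consecutive = from-tops (top-label u (ℓ<u c)) (top-label v (ℓ<v c))

    classify : Classified L
    classify with chain-shape c ≤-refl
    ... | gap-at-w _ w≤1+c ℓ≡ = classify-gap w≤1+c ℓ≡
    ... | consecutive ℓ≡ = Consecutive.classify-consecutive ℓ≡

  open FlipOrbits c t 1 ΦA ∂K-ΦA ΦA-inj
  open OneOrbit c t ΦB ∂K-ΦB (λ _ _ ΦBa≗ΦBa' → ΦBa≗ΦBa' w)
  private
    module A = Transfer c t ΦA (countdown₂ 1) InRange₂ (countdown₂-in-range 1) ∂K-ΦA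
    module B = Transfer c t ΦB countdown InRange countdown-in-range ∂K-ΦB

  ΦA-u≢v : ∀ s → ΦA s u ≢ ΦA s v
  ΦA-u≢v (b , _) = pick-distinct b (<⇒≢ ≤-refl)

  A-not-B : ∀ s a → InRange₂ s → ¬ SameOrbit c t (ΦA s) (ΦB a)
  A-not-B s _ vs (k , back) = ΦA-u≢v (iter (countdown₂ 1) k s)
    (trans (sym (A.iter-∂K k vs u)) (trans (back u) (trans (sym (back v)) (A.iter-∂K k vs v))))

  B-not-A : ∀ a s → InRange a → ¬ SameOrbit c t (ΦB a) (ΦA s)
  B-not-A _ s va (k , back) = ΦA-u≢v s
    (trans (sym (back u)) (trans (B.iter-∂K k va u) (trans (sym (B.iter-∂K k va v)) (back v))))

  orbits-even : Even c → OrbitsAre c t 3 (λ _ → suc (suc c))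
  orbits-even even = rep , sizes , disjoint , covering
    where
    open EvenFlips (Even-2+ even)
    rep : Fin 3 → Labeling c t
    rep Fin.zero = ΦA (true , t) , ΦAt-isLabeling true
    rep (Fin.suc Fin.zero) = ΦA (false , t) , ΦAt-isLabeling false
    rep (Fin.suc (Fin.suc Fin.zero)) = ΦB t , ΦBt-isLabeling
    sizes : ∀ i → OrbitSize c t (proj₁ (rep i)) (suc (suc c))
    sizes Fin.zero = orbit-of true
    sizes (Fin.suc Fin.zero) = orbit-of false
    sizes (Fin.suc (Fin.suc Fin.zero)) = orbit-of-t
    disjoint : ∀ i j → SameOrbit c t (proj₁ (rep i)) (proj₁ (rep j)) → i ≡ j
    disjoint Fin.zero Fin.zero _ = refl
    disjoint (Fin.suc Fin.zero) (Fin.suc Fin.zero) _ = refl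
    disjoint (Fin.suc (Fin.suc Fin.zero)) (Fin.suc (Fin.suc Fin.zero)) _ = refl
    disjoint Fin.zero (Fin.suc Fin.zero) same with separated true false same
    ... | ()
    disjoint (Fin.suc Fin.zero) Fin.zero same with separated false true same
    ... | ()
    disjoint Fin.zero (Fin.suc (Fin.suc Fin.zero)) same = ⊥-elim (A-not-B (true , t) t t-in-range same)
    disjoint (Fin.suc Fin.zero) (Fin.suc (Fin.suc Fin.zero)) same = ⊥-elim (A-not-B (false , t) t t-in-range same)
    disjoint (Fin.suc (Fin.suc Fin.zero)) Fin.zero same = ⊥-elim (B-not-A t (true , t) t-in-range same)
    disjoint (Fin.suc (Fin.suc Fin.zero)) (Fin.suc Fin.zero) same = ⊥-elim (B-not-A t (false , t) t-in-range same)
    covering : ∀ L → IsLabeling c t L → ∃ λ i → SameOrbit c t (proj₁ (rep i)) L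
    covering L isL with classify L isL
    ... | inj₂ (a , va , ΦBa≗L) = Fin.suc (Fin.suc Fin.zero) , in-orbit-of-t va ΦBa≗L
    ... | inj₁ ((b , a) , va , ΦAs≗L) with iter not (t ∸ a) b | reaches-from va ΦAs≗L
    ...   | true | same = Fin.zero , same
    ...   | false | same = Fin.suc Fin.zero , same

  orbits-odd : Odd c → OrbitsAre c t 2 (two (suc (suc c)) (2 * suc (suc c)))
  orbits-odd odd = rep , sizes , disjoint , covering
    where
    open OddFlips (Odd-2+ odd)
    rep : Fin 2 → Labeling c t
    rep Fin.zero = ΦB t , ΦBt-isLabeling
    rep (Fin.suc Fin.zero) = ΦA (true , t) , ΦAt-isLabeling true
    sizes : ∀ i → OrbitSize c t (proj₁ (rep i)) (two (suc (suc c)) (2 * suc (suc c)) i)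
    sizes Fin.zero = orbit-of-t
    sizes (Fin.suc Fin.zero) = orbit-of true
    disjoint : ∀ i j → SameOrbit c t (proj₁ (rep i)) (proj₁ (rep j)) → i ≡ j
    disjoint Fin.zero Fin.zero _ = refl
    disjoint (Fin.suc Fin.zero) (Fin.suc Fin.zero) _ = refl
    disjoint Fin.zero (Fin.suc Fin.zero) same = ⊥-elim (B-not-A t (true , t) t-in-range same)
    disjoint (Fin.suc Fin.zero) Fin.zero same = ⊥-elim (A-not-B (true , t) t t-in-range same)
    covering : ∀ L → IsLabeling c t L → ∃ λ i → SameOrbit c t (proj₁ (rep i)) L
    covering L isL with classify L isL
    ... | inj₂ (a , va , ΦBa≗L) = Fin.zero , in-orbit-of-t va ΦBa≗L
    ... | inj₁ ((_ , _) , va , ΦAs≗L) = Fin.suc Fin.zero , in-orbit-of true va ΦAs≗L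

module CaseC (c : ℕ) where
  open Countdown (suc (suc c))

  -- Of the labels 1, …, t other than a, the chain takes the first c + 1 and u, v the next two.
  lo hi : ℕ → ℕ
  lo a = skip (a ∸ 1) (suc c)
  hi a = skip (a ∸ 1) (suc (suc c))

  lo<hi : ∀ a → lo a < hi a
  lo<hi a = skip-inc (a ∸ 1) (suc c)

  Φ : Bool × ℕ → Elem c → ℕ
  Φ (b , a) = skipLabel c (a ∸ 1) (pick b (lo a) (hi a)) (pick (not b) (lo a) (hi a)) a

  pick≤t : ∀ b a → pick b (lo a) (hi a) ≤ t
  pick≤t b a = pick-≤ b (<⇒≤ (<-≤-trans (lo<hi a) (skip-≤ (a ∸ 1) _))) (skip-≤ (a ∸ 1) _)

  ∂K-wrap : ∀ b → ∂K c t (Φ (b , 2)) ≗E Φ (b , t)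
  ∂K-wrap b = promoted
    where
    open WrapPromotion c t _ _ (pick-⊓ b (<⇒≤ (lo<hi 2))) (pick≤t b 2) (pick≤t (not b) 2) (s≤s (s≤s z≤n))
    lo≡ : lo 2 ∸ 1 ≡ lo t
    lo≡ = sym (skip-< (n≤1+n (suc (suc c))))
    hi≡ : hi 2 ∸ 1 ≡ hi t
    hi≡ = sym (skip-< ≤-refl)
    promoted : ∂K c t (Φ (b , 2)) ≗E Φ (b , t)
    promoted (x j) = trans (∂K-x-wrap j) (sym (skip-< (m≤n⇒m≤1+n (m≤n⇒m≤1+n (s≤s (toℕ≤c j))))))
    promoted u = trans ∂K-u (trans (pick-map (_∸ 1) b) (cong₂ (pick b) lo≡ hi≡))
    promoted v = trans ∂K-v (trans (pick-map (_∸ 1) (not b)) (cong₂ (pick (not b)) lo≡ hi≡))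
    promoted w = ∂K-w

  ∂K-down : ∀ b a → suc (suc (suc a)) ≤ t → ∂K c t (Φ (b , suc (suc (suc a)))) ≗E Φ (not b , suc (suc a))
  ∂K-down b a a<t = promoted
    where
    open ShiftPromotion c t a _ _ (suc (suc (suc a))) (pick-⊓ b (<⇒≤ (lo<hi (suc (suc (suc a))))))
      (s≤s (s≤s z≤n)) (pick≤t b (suc (suc (suc a)))) (pick≤t (not b) (suc (suc (suc a)))) a<t
    hi≡t : hi (suc (suc a)) ≡ t
    hi≡t = skip-≥ (s≤s (≤-pred (≤-pred (≤-pred a<t))))
    promoted : ∂K c t (Φ (b , suc (suc (suc a)))) ≗E Φ (not b , suc (suc a))
    promoted (x j) = ∂K-x-shift j
    promoted u = trans (pick-promoted-u b (lo<hi (suc (suc (suc a)))) ∂K-u-min ∂K-u-max)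
                       (cong (pick (not b) (lo (suc (suc a)))) (sym hi≡t))
    promoted v = trans (pick-promoted-v b (lo<hi (suc (suc (suc a)))) ∂K-v-min ∂K-v-max)
                       (cong (pick (not (not b)) (lo (suc (suc a)))) (sym hi≡t))
    promoted w = ∂K-w-down (s≤s (s≤s (s≤s z≤n)))

  ∂K-Φ : ∀ {s} → InRange₂ s → ∂K c t (Φ s) ≗E Φ (countdown₂ 0 s)
  ∂K-Φ {b , suc (suc zero)} _ = ∂K-wrap b
  ∂K-Φ {b , suc (suc (suc a))} (_ , a<t) = ∂K-down b a a<t
  ∂K-Φ {b , suc zero} (s≤s () , _)

  Φ-inj : ∀ {s s'} → InRange₂ s → InRange₂ s' → Φ s ≗E Φ s' → s ≡ s'
  Φ-inj {b , a} {b' , a'} _ _ Φs≗Φs' with Φs≗Φs' w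
  ... | refl = cong (_, a) (pick-injective (<⇒≢ (lo<hi a)) (Φs≗Φs' u))

  lo-t : lo t ≡ suc (suc c)
  lo-t = skip-< (n≤1+n (suc (suc c)))

  hi-t : hi t ≡ suc (suc (suc c))
  hi-t = skip-< ≤-refl

  Φt-isLabeling : ∀ b → IsLabeling c t (Φ (b , t))
  Φt-isLabeling b = consecutive-isLabeling c t (m≤n⇒m≤1+n (m≤n⇒m≤1+n (n<1+n c)))
    (top<pick b) (pick≤t b t) (top<pick (not b)) (pick≤t (not b) t) (s≤s (s≤s z≤n)) ≤-refl above
    where
    top<pick : ∀ b → suc c < pick b (lo t) (hi t)
    top<pick b = pick-≥ b (≤-reflexive (sym lo-t)) (subst (suc c <_) (sym hi-t) (m≤n⇒m≤1+n ≤-refl))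
    above : ∀ k → suc c < k → k ≤ t → pick b (lo t) (hi t) ≡ k ⊎ pick (not b) (lo t) (hi t) ≡ k ⊎ t ≡ k
    above k c<k k≤t with one-of-three c<k k≤t | pick-lo b | pick-hi b
    ... | inj₁ k≡ | inj₁ lo≡ | _ = inj₁ (trans lo≡ (trans lo-t (sym k≡)))
    ... | inj₁ k≡ | inj₂ lo≡ | _ = inj₂ (inj₁ (trans lo≡ (trans lo-t (sym k≡))))
    ... | inj₂ (inj₁ k≡) | _ | inj₁ hi≡ = inj₁ (trans hi≡ (trans hi-t (sym k≡)))
    ... | inj₂ (inj₁ k≡) | _ | inj₂ hi≡ = inj₂ (inj₁ (trans hi≡ (trans hi-t (sym k≡))))
    ... | inj₂ (inj₂ k≡) | _ | _ = inj₂ (inj₂ (sym k≡))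

  classify : ∀ L → IsLabeling c t L → ∃ λ s → InRange₂ s × Φ s ≗E L
  classify L isL = (b , L w) , (1<w , ≤m w) , skipLabel-≗ chain u≡ v≡ refl
    where
    open Classify c t L isL
    g : ℕ
    g = L w ∸ 1
    w≡1+g : suc g ≡ L w
    w≡1+g = suc-∸1 (<⇒≤ 1<w)

    chain : ∀ n → n ≤ c → ℓ n ≡ skip g n
    chain with chain-shape c ≤-refl
    ... | gap-at-w _ _ ℓ≡ = ℓ≡
    ... | consecutive ℓ≡ with L w ≤? suc c
    ...   | no w≰1+c = λ n n≤c → trans (ℓ≡ n n≤c) (sym (skip-< (≤-<-trans n≤c (∸-monoˡ-≤ 1 (≰⇒> w≰1+c)))))
    ...   | yes w≤1+c = ⊥-elim (two-cannot-cover-three ≤-refl ≤-refl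
                          (above (n<1+n _) (m≤n⇒m≤1+n (n≤1+n _))) (above (s≤s (n≤1+n _)) (n≤1+n _)) (above (s≤s (s≤s (m≤n⇒m≤1+n (n≤1+n c)))) ≤-refl))
      where
      above : ∀ {k} → suc c < k → k ≤ t → L u ≡ k ⊎ L v ≡ k
      above c<k k≤t = hit-by-u-or-v (subst (_< _) (sym (ℓ≡ c ≤-refl)) c<k) k≤t λ w≡k → <⇒≱ c<k (subst (_≤ suc c) w≡k w≤1+c)

    avoids-w : ∀ n → L w ≢ skip g n
    avoids-w n w≡ = skip-omits g n (trans (sym w≡) (sym w≡1+g))

    ℓc<lo : ℓ c < lo (L w)
    ℓc<lo = subst (_< lo (L w)) (sym (chain c ≤-refl)) (skip-inc g c)

    top-pair : ∃ λ b → L u ≡ pick b (lo (L w)) (hi (L w)) × L v ≡ pick (not b) (lo (L w)) (hi (L w))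
    top-pair = pick-cover (<⇒≢ (lo<hi (L w)))
      (hit-by-u-or-v ℓc<lo (<⇒≤ (<-≤-trans (lo<hi (L w)) (skip-≤ g _))) (avoids-w (suc c)))
      (hit-by-u-or-v (<-trans ℓc<lo (lo<hi (L w))) (skip-≤ g _) (avoids-w (suc (suc c))))

    b : Bool
    b = proj₁ top-pair
    u≡ : L u ≡ pick b (lo (L w)) (hi (L w))
    u≡ = proj₁ (proj₂ top-pair)
    v≡ : L v ≡ pick (not b) (lo (L w)) (hi (L w))
    v≡ = proj₂ (proj₂ top-pair)

  open FlipOrbits c t 0 Φ ∂K-Φ Φ-inj

  orbits-even : Even c → OrbitsAre c t 2 (λ _ → suc (suc (suc c)))
  orbits-even even = (λ i → Φ (bit i , t) , Φt-isLabeling (bit i)) , (λ i → orbit-of (bit i)) ,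
    (λ i j same → bit-injective (separated (bit i) (bit j) same)) , covering
    where
    open EvenFlips (Even-2+ even)
    covering : ∀ L → IsLabeling c t L → ∃ λ i → SameOrbit c t (Φ (bit i , t)) L
    covering L isL with classify L isL
    ... | (b , a) , va , Φs≗L = index b' , subst (λ b → SameOrbit c t (Φ (b , t)) L) (sym (bit-index b')) (reaches-from va Φs≗L)
      where
      b' : Bool
      b' = iter not (t ∸ a) b

  orbits-odd : Odd c → OrbitsAre c t 1 (λ _ → 2 * suc (suc (suc c)))
  orbits-odd odd = (λ _ → Φ (true , t) , Φt-isLabeling true) , (λ _ → orbit-of true) , (λ { Fin.zero Fin.zero _ → refl }) ,
    λ L isL → let ((_ , _) , va , Φs≗L) = classify L isL in Fin.zero , in-orbit-of true va Φs≗L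
    where open OddFlips (Odd-2+ odd)

theorem5p1 : (c : ℕ) →
    OrbitsAre c (size c ∸ 2) 1 (λ _ → size c ∸ 2 ∸ 1)
    × ((Even c → OrbitsAre c (size c ∸ 1) 3 (λ _ → size c ∸ 1 ∸ 1))
       × (Odd c → OrbitsAre c (size c ∸ 1) 2 (two (size c ∸ 1 ∸ 1) (2 * (size c ∸ 1 ∸ 1)))))
    × ((Even c → OrbitsAre c (size c) 2 (λ _ → size c ∸ 1))
       × (Odd c → OrbitsAre c (size c) 1 (λ _ → 2 * (size c ∸ 1))))
theorem5p1 c rewrite +-comm c 4 =
  CaseA.orbits c , (CaseB.orbits-even c , CaseB.orbits-odd c) , (CaseC.orbits-even c , CaseC.orbits-odd c)
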